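{- For integers $a,b\geq 1$, the graph $\mathcal{F}_{(a,1,b,1)}$ is isomorphic to an $a\times b$ rectangular grid with one pending edge attached to each node (i.e., each grid node gets a new private neighbor of degree 1). Consequently, it does not have a Hamilton path unless $a\cdot b\leq 2$.
   Context: Let $N=a+b+2$ and label the points of a convex $N$-gon $1,\ldots,N$ counterclockwise; color them according to the pattern: $a$ red points, then $1$ blue point, then $b$ red points, then $1$ blue point. The associahedron $\mathcal{G}_N$ has as nodes all triangulations of the convex $N$-gon, two adjacent if they differ in a flip (removing a diagonal shared by two triangles and replacing it by the other diagonal of the resulting quadrilateral). A triangulation is colorful if no triangle has all three points of the same color; $\mathcal{F}_{(a,1,b,1)}$ is the subgraph of $\mathcal{G}_N$ induced by the colorful triangulations. -}

module Defs where

open import Data.Nat using (ℕ; zero; suc; _+_; _*_; _∸_; _≤_; _<_)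
import Data.Nat as ℕ
open import Data.Bool using (Bool; true; false; _∧_; _∨_; not; T; if_then_else_)
open import Data.Fin using (Fin; toℕ)
open import Data.List using (List)
open import Data.Bool.ListAction using (all; any)
open import Data.List.Base using (allFin)
open import Data.Vec using (Vec; lookup)
open import Data.Product using (Σ; _×_; _,_; proj₁)
open import Data.Unit using (⊤)
open import Data.Empty using (⊥)
open import Relation.Nullary using (¬_)
open import Relation.Nullary.Decidable using (⌊_⌋)
open import Relation.Binary.PropositionalEquality using (_≡_)
open import Function.Bundles using (_⤖_; _⇔_; Bijection)
open import Data.List.Relation.Unary.Linked using (Linked)
open import Data.List.Relation.Unary.Unique.Propositional using (Unique)
open import Data.List.Membership.Propositional using (_∈_)

record Graph : Set₁ where
  field
    V : Set
    E : V → V → Set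

open Graph public

record _≅_ (G H : Graph) : Set where
  field
    bij : V G ⤖ V H
    adj : ∀ u v → E G u v ⇔ E H (Bijection.to bij u) (Bijection.to bij v)

record HamiltonPath (G : Graph) : Set where
  field
    path     : List (V G)
    unique   : Unique path
    covering : ∀ v → v ∈ path
    linked   : Linked (E G) path

_==_ : ℕ → ℕ → Bool
m == n = ⌊ m ℕ.≟ n ⌋

_<ᵇ_ : ℕ → ℕ → Bool
m <ᵇ n = ⌊ m ℕ.<? n ⌋

∀Fin : ∀ {n} → (Fin n → Bool) → Bool
∀Fin {n} p = all p (allFin n)

∃Fin : ∀ {n} → (Fin n → Bool) → Bool
∃Fin {n} p = any p (allFin n)

-- Convex N-gon with points 0,…,N-1 (the paper's 1,…,N) in
-- counterclockwise order.  A set of diagonals is a Boolean matrix S;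
-- S[i][j] = true (with i < j) means the diagonal {i,j} is present.

DiagSet : ℕ → Set
DiagSet N = Vec (Vec Bool N) N

module Polygon (N : ℕ) where

  mem : DiagSet N → Fin N → Fin N → Bool
  mem S i j = lookup (lookup S i) j

  side : Fin N → Fin N → Bool
  side i j = (suc (toℕ i) == toℕ j) ∨ ((toℕ i == 0) ∧ (suc (toℕ j) == N))

  diagonal : Fin N → Fin N → Bool
  diagonal i j = (toℕ i <ᵇ toℕ j) ∧ not (side i j)

  cross : Fin N → Fin N → Fin N → Fin N → Bool
  cross i j k l =
    ((toℕ i <ᵇ toℕ k) ∧ (toℕ k <ᵇ toℕ j) ∧ (toℕ j <ᵇ toℕ l))
    ∨ ((toℕ k <ᵇ toℕ i) ∧ (toℕ i <ᵇ toℕ l) ∧ (toℕ l <ᵇ toℕ j))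

  onlyDiagonals : DiagSet N → Bool
  onlyDiagonals S = ∀Fin λ i → ∀Fin λ j → not (mem S i j) ∨ diagonal i j

  nonCrossing : DiagSet N → Bool
  nonCrossing S = ∀Fin λ i → ∀Fin λ j → ∀Fin λ k → ∀Fin λ l →
    not (mem S i j ∧ mem S k l ∧ cross i j k l)

  maximal : DiagSet N → Bool
  maximal S = ∀Fin λ i → ∀Fin λ j →
    not (diagonal i j) ∨ mem S i j ∨
    (∃Fin λ k → ∃Fin λ l → mem S k l ∧ cross i j k l)

  isTriangulation : DiagSet N → Bool
  isTriangulation S = onlyDiagonals S ∧ nonCrossing S ∧ maximal S

  edge : DiagSet N → Fin N → Fin N → Bool
  edge S i j = side i j ∨ mem S i j

  triangle : DiagSet N → Fin N → Fin N → Fin N → Bool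
  triangle S i j k = (toℕ i <ᵇ toℕ j) ∧ (toℕ j <ᵇ toℕ k)
    ∧ edge S i j ∧ edge S j k ∧ edge S i k

  colorful : (Fin N → Bool) → DiagSet N → Bool
  colorful col S = ∀Fin λ i → ∀Fin λ j → ∀Fin λ k →
    not (triangle S i j k ∧ (col i ≡ᵇ col j) ∧ (col j ≡ᵇ col k))
    where
      _≡ᵇ_ : Bool → Bool → Bool
      true  ≡ᵇ y = y
      false ≡ᵇ y = not y

  -- S' arises from S by a flip: a diagonal d = {i,j} of S is replaced by
  -- the crossing diagonal d' = {k,l} (the other diagonal of the
  -- quadrilateral formed by the two triangles sharing d), all other
  -- diagonals unchanged.
  Flip : DiagSet N → DiagSet N → Set
  Flip S S' = Σ (Fin N) λ i → Σ (Fin N) λ j → Σ (Fin N) λ k → Σ (Fin N) λ l →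
    T (mem S i j) × T (not (mem S' i j)) ×
    T (mem S' k l) × T (not (mem S k l)) ×
    T (cross i j k l) ×
    (∀ x y → ¬ (x ≡ i × y ≡ j) → ¬ (x ≡ k × y ≡ l) → mem S x y ≡ mem S' x y)

-- The colouring (a,1,b,1): points 0..a-1 red, a blue, a+1..a+b red,
-- a+b+1 blue.  true = blue, false = red.

colour : (a b : ℕ) → Fin (a + b + 2) → Bool
colour a b i = (toℕ i == a) ∨ (toℕ i == (a + b + 1))

F : (a b : ℕ) → Graph
F a b = record
  { V = Σ (DiagSet N) (λ S → T (isTriangulation S ∧ colorful (colour a b) S))
  ; E = λ S S' → Flip (proj₁ S) (proj₁ S')
  }
  where
    N = a + b + 2
    open Polygon N

-- The a×b grid with one pendant edge attached to every node.
-- Vertex (i , j , false) is the grid node (i,j); (i , j , true) is its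
-- private pendant neighbour.

data GridPendAdj (a b : ℕ) : Fin a × Fin b × Bool → Fin a × Fin b × Bool → Set where
  horiz : ∀ i j j' → suc (toℕ j) ≡ toℕ j' →
          GridPendAdj a b (i , j , false) (i , j' , false)
  horiz' : ∀ i j j' → suc (toℕ j') ≡ toℕ j →
          GridPendAdj a b (i , j , false) (i , j' , false)
  vert  : ∀ i i' j → suc (toℕ i) ≡ toℕ i' →
          GridPendAdj a b (i , j , false) (i' , j , false)
  vert' : ∀ i i' j → suc (toℕ i') ≡ toℕ i →
          GridPendAdj a b (i , j , false) (i' , j , false)
  pend  : ∀ i j → GridPendAdj a b (i , j , false) (i , j , true)
  pend' : ∀ i j → GridPendAdj a b (i , j , true) (i , j , false)

GridWithPendants : (a b : ℕ) → Graph
GridWithPendants a b = record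
  { V = Fin a × Fin b × Bool
  ; E = GridPendAdj a b
  }

{-# OPTIONS --safe #-}

-- The blue points a and Q = a+b+1 cut the polygon into the red chains A = 0..a-1 and
-- B = a+1..a+b.  A diagonal spanning only red points is impossible, since the apex of the
-- triangle on it would be red too; and a diagonal from A to B has apex a for the same reason.
-- Hence a colorful triangulation is fixed by the least neighbour X ∈ A of a, the greatest
-- neighbour Y ∈ B of a, and whether {a,Q} or {X,Y} cuts the quadrilateral X a Y Q: it is one
-- of the a·b·2 fan triangulations T(X,Y,t).  A flip either moves X or Y by one while {a,Q} is
-- present (a grid edge) or exchanges {a,Q} and {X,Y} (a pendant edge).  Each of the a·b
-- pendant vertices has to be an end of a Hamilton path, so there is none once a·b ≥ 3.
module Submission where

open import Defs
open import Level using (0ℓ)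
open import Data.Nat using (ℕ; zero; suc; _+_; _∸_; _*_; _≤_; _<_; _≟_; _≤?_; _<?_; s≤s; z≤n; s≤s⁻¹)
open import Data.Nat.Properties
open import Data.Fin as Fin using (Fin; toℕ; fromℕ<; inject≤; remQuot) renaming (zero to fzero; suc to fsuc)
open import Data.Fin.Properties
  using (pigeonhole; inject≤-injective; *↔×; ¬∀⟶∃¬; toℕ<n; toℕ-fromℕ<; fromℕ<-toℕ; toℕ-injective)
open import Data.Bool using (Bool; true; false; T; not; _∧_; _∨_)
open import Data.Bool.Properties using (T-∧; T-∨; T-irrelevant; ¬-not) renaming (_≟_ to _≟ᵇ_)
open import Data.Product using (Σ; _×_; _,_; proj₁; proj₂; ∃; ∃₂)
open import Data.Product.Function.NonDependent.Propositional using (_×-⇔_)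
open import Data.Sum using (_⊎_; inj₁; inj₂; [_,_]; [_,_]′)
import Data.Sum as Sum
open import Data.Sum.Function.Propositional using (_⊎-⇔_)
open import Data.Unit using (tt)
open import Data.Empty using (⊥; ⊥-elim)
open import Data.List using (List; []; _∷_; map; allFin)
open import Data.List.Membership.Propositional using (_∈_; lose)
open import Data.List.Membership.Propositional.Properties using (∈-map⁺; ∈-allFin)
open import Data.List.Relation.Unary.Any using (here; there)
open import Data.List.Relation.Unary.AllPairs using (_∷_)
open import Data.List.Relation.Unary.All using (_∷_)
open import Data.List.Relation.Unary.Linked as Linked using (Linked; _∷_)
open import Data.List.Relation.Unary.Unique.Propositional using (Unique)
import Data.List.Relation.Unary.All as All
import Data.List.Relation.Unary.All.Properties as All
import Data.List.Relation.Unary.Any as Any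
import Data.List.Relation.Unary.Any.Properties as Any
import Data.List.Relation.Unary.Linked.Properties as Linked
import Data.List.Relation.Unary.Unique.Propositional.Properties as Unique
open import Data.Vec using (tabulate; lookup)
open import Data.Vec.Properties using (lookup∘tabulate; tabulate∘lookup; tabulate-cong)
open import Function using (_∘_; const)
open import Function.Bundles using (_⇔_; mk⇔; mk⤖; Bijection; Injection; Equivalence)
open import Function.Construct.Composition using (_⇔-∘_)
open import Function.Construct.Identity using (⇔-id)
open import Function.Construct.Symmetry using (⇔-sym)
open import Function.Definitions using (Injective)
open import Function.Properties.Inverse using (↔⇒↣)
open import Function.Related.TypeIsomorphisms using (¬-cong-⇔)
open import Relation.Nullary using (¬_; Dec; does; yes; no; contradiction)
open import Relation.Nullary.Decidable
  using (⌊_⌋; toWitness; fromWitness; T?; decidable-stable; dec-true; dec-false; map′; _×-dec_; _⊎-dec_)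
open import Relation.Binary using (Rel; _⇒_; Decidable; tri<; tri≈; tri>)
import Relation.Unary as U
open import Relation.Binary.PropositionalEquality
  using (_≡_; _≢_; ≢-sym; refl; sym; trans; cong; subst; subst₂; module ≡-Reasoning)

open Equivalence using (to; from)

≅-HamiltonPath : ∀ {G H} → G ≅ H → HamiltonPath G → HamiltonPath H
≅-HamiltonPath {G} {H} G≅H γ = record
  { path     = map φ path
  ; unique   = Unique.map⁺ injective unique
  ; covering = λ v → let u , φu≡v = strictlySurjective v in subst (_∈ map φ path) φu≡v (∈-map⁺ φ (covering u))
  ; linked   = Linked.map⁺ (Linked.map (λ {u} {v} → to (_≅_.adj G≅H u v)) linked)
  }
  where
  open Bijection (_≅_.bij G≅H) using (injective; strictlySurjective) renaming (to to φ)
  open HamiltonPath γ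

record Pendant (G : Graph) (v : V G) : Set where
  field
    anchor  : V G
    into    : ∀ {u} → E G u v → u ≡ anchor
    out-of  : ∀ {w} → E G v w → w ≡ anchor

lastOf : ∀ {A : Set} → A → List A → A
lastOf x []       = x
lastOf _ (y ∷ ys) = lastOf y ys

-- Both path-neighbours of an inner pendant vertex would be its anchor.
pendant-at-end : ∀ {G v} → Pendant G v → (x : V G) (xs : List (V G)) →
                 Linked (E G) (x ∷ xs) → Unique (x ∷ xs) → v ∈ x ∷ xs → v ≡ x ⊎ v ≡ lastOf x xs
pendant-at-end p x xs       _                  _                 (here v≡x) = inj₁ v≡x
pendant-at-end p x (y ∷ ys) (_ ∷ linked) (_ ∷ unique) (there v∈ys)
  with pendant-at-end p y ys linked unique v∈ys
... | inj₂ v≡last = inj₂ v≡last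
pendant-at-end p x (y ∷ [])     _                  _                   _ | inj₁ v≡y = inj₂ v≡y
pendant-at-end p x (y ∷ z ∷ zs) (x~y ∷ y~z ∷ _) ((_ ∷ x≢z ∷ _) ∷ _) _ | inj₁ refl =
  ⊥-elim (x≢z (trans (Pendant.into p x~y) (sym (Pendant.out-of p y~z))))

module _ {A : Set} {x y : A} where

  private
    side : ∀ {v} → v ≡ x ⊎ v ≡ y → Fin 2
    side = [ const fzero , const (fsuc fzero) ]

    same-side : ∀ {u v} (eu : u ≡ x ⊎ u ≡ y) (ev : v ≡ x ⊎ v ≡ y) → side eu ≡ side ev → u ≡ v
    same-side (inj₁ refl) (inj₁ refl) _ = refl
    same-side (inj₂ refl) (inj₂ refl) _ = refl

  ¬Fin3↣pair : (f : Fin 3 → A) → Injective _≡_ _≡_ f → ¬ (∀ k → f k ≡ x ⊎ f k ≡ y)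
  ¬Fin3↣pair f f-injective end with i , j , i<j , same ← pigeonhole (s≤s (s≤s (s≤s z≤n))) (side ∘ end) =
    <⇒≢ i<j (cong toℕ (f-injective (same-side (end i) (end j) same)))

three-pendants⇒¬HamiltonPath : ∀ {G} (p : Fin 3 → V G) → Injective _≡_ _≡_ p →
                               (∀ k → Pendant G (p k)) → ¬ HamiltonPath G
three-pendants⇒¬HamiltonPath p _ _ record { path = [] ; covering = covering } with covering (p fzero)
... | ()
three-pendants⇒¬HamiltonPath p p-injective pendant
  record { path = x ∷ xs ; unique = unique ; covering = covering ; linked = linked } =
  ¬Fin3↣pair p p-injective λ k → pendant-at-end (pendant k) x xs linked unique (covering (p k))

grid-pendant : ∀ {a b} (i : Fin a) (j : Fin b) → Pendant (GridWithPendants a b) (i , j , true)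
grid-pendant i j = record
  { anchor = i , j , false ; into = λ { (pend _ _) → refl } ; out-of = λ { (pend' _ _) → refl } }

GridWithPendants-¬HamiltonPath : ∀ a b → 2 < a * b → ¬ HamiltonPath (GridWithPendants a b)
GridWithPendants-¬HamiltonPath a b 3≤ab =
  three-pendants⇒¬HamiltonPath leaf leaf-injective (λ _ → grid-pendant _ _)
  where
  leaf : Fin 3 → Fin a × Fin b × Bool
  leaf k = let i , j = remQuot b (inject≤ k 3≤ab) in i , j , true

  leaf-injective : Injective _≡_ _≡_ leaf
  leaf-injective eq = inject≤-injective _ _ _ _
    (Injection.injective (↔⇒↣ *↔×) (cong (λ (i , j , _) → i , j) eq))

greatest-below : ∀ {P : ℕ → Set} → U.Decidable P → ∀ {m n} → m < n → P m →
                 ∃ λ k → k < n × P k × (∀ {l} → k < l → l < n → ¬ P l)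
greatest-below {P} P? {m} {suc n} m<1+n Pm with P? n
... | yes Pn = n , n<1+n n , Pn , λ n<l l<1+n → contradiction (s≤s⁻¹ l<1+n) (<⇒≱ n<l)
... | no ¬Pn =
  let k , k<n , Pk , above = greatest-below P? m<n Pm
  in k , m<n⇒m<1+n k<n , Pk , λ k<l l<1+n → [ above k<l , (λ { refl → ¬Pn }) ]′ (m<1+n⇒m<n∨m≡n l<1+n)
  where
  m<n : m < n
  m<n = ≤∧≢⇒< (s≤s⁻¹ m<1+n) λ { refl → ¬Pn Pm }

least-satisfying : ∀ {P : ℕ → Set} → U.Decidable P → ∀ {m} → P m →
                   ∃ λ k → k ≤ m × P k × (∀ {l} → l < k → ¬ P l)
least-satisfying P? {zero} P0 = 0 , z≤n , P0 , λ ()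
least-satisfying P? {suc m} Pm with P? 0
... | yes P0 = 0 , z≤n , P0 , λ ()
... | no ¬P0 =
  let k , k≤m , Pk , below = least-satisfying (P? ∘ suc) Pm
  in suc k , s≤s k≤m , Pk , λ { {zero} _ → ¬P0 ; {suc l} l<k → below (s≤s⁻¹ l<k) }

T-∀Fin : ∀ {n} {p : Fin n → Bool} → T (∀Fin p) ⇔ (∀ i → T (p i))
T-∀Fin {n} {p} = mk⇔ (λ h i → All.lookup (All.all⁺ p (allFin n) h) (∈-allFin i))
                     (λ f → All.all⁻ p {xs = allFin n} (All.tabulate λ {i} _ → f i))

T-∃Fin : ∀ {n} {p : Fin n → Bool} → T (∃Fin p) ⇔ ∃ λ i → T (p i)
T-∃Fin {n} {p} = mk⇔ (Any.satisfied ∘ Any.any⁻ p (allFin n))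
                     (λ (i , pi) → Any.any⁺ p (lose (∈-allFin i) pi))

¬T-∀Fin : ∀ {n} {p : Fin n → Bool} → ¬ T (∀Fin p) → ∃ λ i → ¬ T (p i)
¬T-∀Fin {n} {p} ¬h = ¬∀⟶∃¬ n (T ∘ p) (T? ∘ p) (¬h ∘ from T-∀Fin)

T-isYes : ∀ {A : Set} {d : Dec A} → T ⌊ d ⌋ ⇔ A
T-isYes = mk⇔ toWitness fromWitness

T-not : ∀ {x} → T (not x) ⇔ (¬ T x)
T-not {true}  = mk⇔ (λ ()) (λ ¬t → ¬t tt)
T-not {false} = mk⇔ (λ _ ()) (λ _ → tt)

T-⇒ : ∀ {x y} → T (not x ∨ y) ⇔ (T x → T y)
T-⇒ {true}  = mk⇔ const (λ f → f tt)
T-⇒ {false} = mk⇔ (λ _ ()) (λ _ → tt)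

T-injective : ∀ {x y} → (T x ⇔ T y) → x ≡ y
T-injective {false} {false} _ = refl
T-injective {false} {true}  e = ⊥-elim (from e tt)
T-injective {true}  {false} e = ⊥-elim (to e tt)
T-injective {true}  {true}  _ = refl

T-<ᵇ³ : ∀ {x y z w} → T ((x <ᵇ y) ∧ (y <ᵇ z) ∧ (z <ᵇ w)) ⇔ (x < y × y < z × z < w)
T-<ᵇ³ {x} {y} {z} = (T-isYes ×-⇔ (T-isYes ×-⇔ T-isYes) ⇔-∘ T-∧ {y <ᵇ z}) ⇔-∘ T-∧ {x <ᵇ y}

FinView : ℕ → ℕ → Set
FinView n i = ∃ λ (f : Fin n) → toℕ f ≡ i

finView : ∀ {n i} → i < n → FinView n i
finView i<n = fromℕ< i<n , toℕ-fromℕ< i<n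

module ConvexPolygon (n : ℕ) where

  Side : Rel ℕ 0ℓ
  Side i j = suc i ≡ j ⊎ (i ≡ 0 × suc j ≡ n)

  side? : Decidable Side
  side? i j = (suc i ≟ j) ⊎-dec ((i ≟ 0) ×-dec (suc j ≟ n))

  Diagonal : Rel ℕ 0ℓ
  Diagonal i j = i < j × ¬ Side i j

  Diagonal⇒1+i<j : ∀ {i j} → Diagonal i j → suc i < j
  Diagonal⇒1+i<j (i<j , ¬side) = ≤∧≢⇒< i<j (¬side ∘ inj₁)

  Cross : ℕ → ℕ → ℕ → ℕ → Set
  Cross i j k l = (i < k × k < j × j < l) ⊎ (k < i × i < l × l < j)

  Cross-sym : ∀ {i j k l} → Cross i j k l → Cross k l i j
  Cross-sym (inj₁ c) = inj₂ c
  Cross-sym (inj₂ c) = inj₁ c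

  ¬Cross-from-same : ∀ {i j l} → ¬ Cross i j i l
  ¬Cross-from-same (inj₁ (i<i , _)) = <-irrefl refl i<i
  ¬Cross-from-same (inj₂ (i<i , _)) = <-irrefl refl i<i

  ¬Cross-to-same : ∀ {i j k} → ¬ Cross i j k j
  ¬Cross-to-same (inj₁ (_ , _ , j<j)) = <-irrefl refl j<j
  ¬Cross-to-same (inj₂ (_ , _ , j<j)) = <-irrefl refl j<j

  ¬Cross-end-to-start : ∀ {i j l} → ¬ Cross i j j l
  ¬Cross-end-to-start (inj₁ (_ , j<j , _)) = <-irrefl refl j<j
  ¬Cross-end-to-start (inj₂ (j<i , i<l , l<j)) = <-irrefl refl (<-trans j<i (<-trans i<l l<j))

  Edge : Rel ℕ 0ℓ → Rel ℕ 0ℓ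
  Edge R i j = Side i j ⊎ R i j

  Edge-map : ∀ {R R′} → R ⇒ R′ → Edge R ⇒ Edge R′
  Edge-map f = Sum.map₂ f

  Triangle : Rel ℕ 0ℓ → ℕ → ℕ → ℕ → Set
  Triangle R i j k = i < j × j < k × k < n × Edge R i j × Edge R j k × Edge R i k

  record IsNonCrossing (R : Rel ℕ 0ℓ) : Set where
    field
      diagonal    : ∀ {i j} → R i j → Diagonal i j × j < n
      nonCrossing : ∀ {i j k l} → R i j → R k l → ¬ Cross i j k l

  Edge-nonCrossing : ∀ {R} → IsNonCrossing R → ∀ {i j k l} → R i j → Edge R k l → ¬ Cross i j k l
  Edge-nonCrossing _ _ (inj₁ (inj₁ refl)) (inj₁ (_ , k<j , j<1+k)) = <⇒≱ k<j (s≤s⁻¹ j<1+k)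
  Edge-nonCrossing _ _ (inj₁ (inj₁ refl)) (inj₂ (k<i , i<1+k , _)) = <⇒≱ k<i (s≤s⁻¹ i<1+k)
  Edge-nonCrossing _ _ (inj₁ (inj₂ (refl , _))) (inj₁ (i<0 , _)) = n≮0 i<0
  Edge-nonCrossing R-nc ij (inj₁ (inj₂ (refl , 1+l≡n))) (inj₂ (_ , _ , l<j)) =
    <⇒≱ l<j (s≤s⁻¹ (subst (_ <_) (sym 1+l≡n) (proj₂ (IsNonCrossing.diagonal R-nc ij))))
  Edge-nonCrossing R-nc ij (inj₂ kl) = IsNonCrossing.nonCrossing R-nc ij kl

  Maximal : Rel ℕ 0ℓ → Set
  Maximal R = ∀ {i j} → j < n → Diagonal i j → ¬ R i j → ∃₂ λ k l → R k l × Cross i j k l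

  record IsTriangulation (R : Rel ℕ 0ℓ) : Set where
    field
      isNonCrossing : IsNonCrossing R
      maximal       : Maximal R

    open IsNonCrossing isNonCrossing public

  Colorful : (ℕ → Bool) → Rel ℕ 0ℓ → Set
  Colorful colour R = ∀ {i j k} → Triangle R i j k → colour i ≡ colour j → colour j ≡ colour k → ⊥

  module _ {R : Rel ℕ 0ℓ} (R-tri : IsTriangulation R) (R? : Decidable R) where
    open IsTriangulation R-tri

    edge? : Decidable (Edge R)
    edge? i j = side? i j ⊎-dec R? i j

    -- The apex is the last point k seen from i along an edge; were {k,j} no edge, the
    -- diagonal crossing it would cross {i,j} or {i,k}, or be a later edge from i.
    apex : ∀ {i j} → R i j → ∃ λ k → Triangle R i k j
    apex {i} {j} ij
      with d , j<n ← diagonal ij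
      with k , k<j , (i<k , ik) , beyond ← greatest-below (λ k → (i <? k) ×-dec edge? i k)
                                                          (Diagonal⇒1+i<j d) (n<1+n i , inj₁ (inj₁ refl))
      = k , i<k , k<j , j<n , ik , kj , inj₂ ij
      where
      ¬crossing : ∀ {u v} → R u v → ¬ Cross k j u v
      ¬crossing uv (inj₁ (k<u , u<j , j<v)) = nonCrossing ij uv (inj₁ (<-trans i<k k<u , u<j , j<v))
      ¬crossing {u} {v} uv (inj₂ (u<k , k<v , v<j)) with <-cmp u i
      ... | tri< u<i _ _ = nonCrossing ij uv (inj₂ (u<i , <-trans i<k k<v , v<j))
      ... | tri≈ _ refl _ = beyond k<v v<j (<-trans i<k k<v , inj₂ uv)
      ... | tri> _ _ i<u = Edge-nonCrossing isNonCrossing uv ik (inj₂ (i<u , u<k , k<v))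

      kj : Edge R k j
      kj with edge? k j
      ... | yes e = e
      ... | no ¬e = let _ , _ , uv , c = maximal j<n (k<j , ¬e ∘ inj₁) (¬e ∘ inj₂) in ⊥-elim (¬crossing uv c)

    ⊆-nonCrossing⇒⊇ : ∀ {R′} → IsNonCrossing R′ → R ⇒ R′ → R′ ⇒ R
    ⊆-nonCrossing⇒⊇ {R′} R′-nc R⇒R′ {i} {j} ij with R? i j
    ... | yes ij∈R = ij∈R
    ... | no ij∉R = let _ , _ , kl , c = maximal (proj₂ (diagonal′ ij)) (proj₁ (diagonal′ ij)) ij∉R
                    in ⊥-elim (nonCrossing′ ij (R⇒R′ kl) c)
      where open IsNonCrossing R′-nc renaming (diagonal to diagonal′; nonCrossing to nonCrossing′)

    ¬monochromatic-span : ∀ {colour : ℕ → Bool} {c} → Colorful colour R → ∀ {i j} → R i j →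
                         ¬ (∀ {k} → i ≤ k → k ≤ j → colour k ≡ c)
    ¬monochromatic-span colorful ij mono with apex ij
    ... | k , tri@(i<k , k<j , _) =
      colorful tri (trans (mono ≤-refl (<⇒≤ (<-trans i<k k<j))) (sym (mono (<⇒≤ i<k) (<⇒≤ k<j))))
                   (trans (mono (<⇒≤ i<k) (<⇒≤ k<j)) (sym (mono (<⇒≤ (<-trans i<k k<j)) ≤-refl)))

  record Flip (R R′ : Rel ℕ 0ℓ) : Set where
    field
      I J K L  : ℕ
      removed  : R I J
      added    : R′ K L
      crossing : Cross I J K L
      kept     : R ⇒ λ u v → R′ u v ⊎ (u ≡ I × v ≡ J)
      kept′    : R′ ⇒ λ u v → R u v ⊎ (u ≡ K × v ≡ L)

    added-unique : ∀ {u v u′ v′} → R′ u v → ¬ R u v → R′ u′ v′ → ¬ R u′ v′ → u ≡ u′ × v ≡ v′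
    added-unique r′ ¬r s′ ¬s with kept′ r′ | kept′ s′
    ... | inj₁ r | _ = ⊥-elim (¬r r)
    ... | inj₂ _ | inj₁ s = ⊥-elim (¬s s)
    ... | inj₂ (refl , refl) | inj₂ (refl , refl) = refl , refl

    removed-unique : ∀ {u v u′ v′} → R u v → ¬ R′ u v → R u′ v′ → ¬ R′ u′ v′ → u ≡ u′ × v ≡ v′
    removed-unique r ¬r′ s ¬s′ with kept r | kept s
    ... | inj₁ r′ | _ = ⊥-elim (¬r′ r′)
    ... | inj₂ _ | inj₁ s′ = ⊥-elim (¬s′ s′)
    ... | inj₂ (refl , refl) | inj₂ (refl , refl) = refl , refl

  Flip-sym : ∀ {R R′} → Flip R R′ → Flip R′ R
  Flip-sym f = record { I = K ; J = L ; K = I ; L = J ; removed = added ; added = removed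
                      ; crossing = Cross-sym crossing ; kept = kept′ ; kept′ = kept }
    where open Flip f

  ¬Flip-refl : ∀ {R} → IsNonCrossing R → ¬ Flip R R
  ¬Flip-refl R-nc f = IsNonCrossing.nonCrossing R-nc (Flip.removed f) (Flip.added f) (Flip.crossing f)

module Encoding (n : ℕ) where
  open ConvexPolygon n
  module P = Polygon n
  open P using (mem)

  T-side : ∀ {i j} → T (P.side i j) ⇔ Side (toℕ i) (toℕ j)
  T-side {i} {j} = (T-isYes ⊎-⇔ (T-isYes ×-⇔ T-isYes) ⇔-∘ T-∧ {toℕ i == 0}) ⇔-∘ T-∨ {suc (toℕ i) == toℕ j}

  T-diagonal : ∀ {i j} → T (P.diagonal i j) ⇔ Diagonal (toℕ i) (toℕ j)
  T-diagonal {i} {j} = (T-isYes ×-⇔ ¬-cong-⇔ T-side ⇔-∘ T-not) ⇔-∘ T-∧ {toℕ i <ᵇ toℕ j}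

  T-cross : ∀ {i j k l} → T (P.cross i j k l) ⇔ Cross (toℕ i) (toℕ j) (toℕ k) (toℕ l)
  T-cross {i} {j} {k} {l} =
    (T-<ᵇ³ {toℕ i} {toℕ k} {toℕ j} {toℕ l} ⊎-⇔ T-<ᵇ³ {toℕ k} {toℕ i} {toℕ l} {toℕ j})
    ⇔-∘ T-∨ {(toℕ i <ᵇ toℕ k) ∧ (toℕ k <ᵇ toℕ j) ∧ (toℕ j <ᵇ toℕ l)}

  record Represents (S : DiagSet n) (R : Rel ℕ 0ℓ) : Set where
    field
      mem⇔    : ∀ {i j} → T (mem S i j) ⇔ R (toℕ i) (toℕ j)
      bounded : ∀ {i j} → R i j → i < n × j < n

  module _ {S R} (S≈R : Represents S R) where
    open Represents S≈R

    T-edge : ∀ {i j} → T (P.edge S i j) ⇔ Edge R (toℕ i) (toℕ j)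
    T-edge {i} {j} = (T-side ⊎-⇔ mem⇔) ⇔-∘ T-∨ {P.side i j}

    T-triangle : ∀ {i j k} → T (P.triangle S i j k) ⇔ Triangle R (toℕ i) (toℕ j) (toℕ k)
    T-triangle {i} {j} {k} = mk⇔
      (λ t → let i<j , j<k , edges = to T-triangle′ t in i<j , j<k , toℕ<n k , edges)
      (λ (i<j , j<k , _ , edges) → from T-triangle′ (i<j , j<k , edges))
      where
      T-triangle′ : T (P.triangle S i j k) ⇔ (toℕ i < toℕ j × toℕ j < toℕ k × Edge R (toℕ i) (toℕ j) ×
                                              Edge R (toℕ j) (toℕ k) × Edge R (toℕ i) (toℕ k))
      T-triangle′ = (T-isYes ×-⇔ (T-isYes ×-⇔ (T-edge ×-⇔ (T-edge ×-⇔ T-edge) ⇔-∘ T-∧ {P.edge S j k})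
                                                ⇔-∘ T-∧ {P.edge S i j})
                              ⇔-∘ T-∧ {toℕ j <ᵇ toℕ k})
                    ⇔-∘ T-∧ {toℕ i <ᵇ toℕ j}

    T-onlyDiagonals : T (P.onlyDiagonals S) ⇔ (∀ {i j} → R i j → Diagonal i j × j < n)
    T-onlyDiagonals = mk⇔
      (λ h {_} {_} r → let i<n , j<n = bounded r in diagonal-at h r (finView i<n) (finView j<n))
      (λ f → from (T-∀Fin {n}) λ i → from (T-∀Fin {n}) λ j →
               from T-⇒ λ m → from T-diagonal (proj₁ (f (to mem⇔ m))))
      where
      diagonal-at : T (P.onlyDiagonals S) → ∀ {i j} → R i j →
                    FinView n i → FinView n j → Diagonal i j × j < n
      diagonal-at h r (fi , refl) (fj , refl) =
        to T-diagonal (to T-⇒ (to (T-∀Fin {n}) (to (T-∀Fin {n}) h fi) fj) (from mem⇔ r)) , toℕ<n fj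

    T-nonCrossing : T (P.nonCrossing S) ⇔ (∀ {i j k l} → R i j → R k l → ¬ Cross i j k l)
    T-nonCrossing = mk⇔
      (λ h {_} {_} {_} {_} r r′ →
         let i<n , j<n = bounded r ; k<n , l<n = bounded r′
         in crossing-at h r r′ (finView i<n) (finView j<n) (finView k<n) (finView l<n))
      (λ f → from (T-∀Fin {n}) λ i → from (T-∀Fin {n}) λ j → from (T-∀Fin {n}) λ k → from (T-∀Fin {n}) λ l →
         from T-not λ t → let m , rest = to (T-∧ {mem S i j}) t ; m′ , c = to (T-∧ {mem S k l}) rest
                          in f (to mem⇔ m) (to mem⇔ m′) (to T-cross c))
      where
      crossing-at : T (P.nonCrossing S) → ∀ {i j k l} → R i j → R k l →
                    FinView n i → FinView n j → FinView n k → FinView n l →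
                    ¬ Cross i j k l
      crossing-at h r r′ (fi , refl) (fj , refl) (fk , refl) (fl , refl) c =
        to T-not (to (T-∀Fin {n}) (to (T-∀Fin {n}) (to (T-∀Fin {n}) (to (T-∀Fin {n}) h fi) fj) fk) fl)
           (from (T-∧ {mem S fi fj}) (from mem⇔ r , from (T-∧ {mem S fk fl}) (from mem⇔ r′ , from T-cross c)))

    T-maximal : T (P.maximal S) ⇔ Maximal R
    T-maximal = mk⇔
      (λ h {_} {_} j<n d → maximal-at h (finView (<-trans (proj₁ d) j<n)) (finView j<n) d)
      (λ f → from (T-∀Fin {n}) λ i → from (T-∀Fin {n}) λ j →
               from T-⇒ λ d → from (T-∨ {mem S i j}) (completion f d))
      where
      maximal-at : T (P.maximal S) → ∀ {i j} → FinView n i → FinView n j →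
                   Diagonal i j → ¬ R i j → ∃₂ λ k l → R k l × Cross i j k l
      maximal-at h (fi , refl) (fj , refl) d ¬r
        with to (T-∨ {mem S fi fj}) (to T-⇒ (to (T-∀Fin {n}) (to (T-∀Fin {n}) h fi) fj) (from T-diagonal d))
      ... | inj₁ m = ⊥-elim (¬r (to mem⇔ m))
      ... | inj₂ e = let fk , e′ = to T-∃Fin e ; fl , t = to T-∃Fin e′ ; m , c = to (T-∧ {mem S fk fl}) t
                     in toℕ fk , toℕ fl , to mem⇔ m , to T-cross c

      crossing-witness : ∀ {fi fj k l} → R k l → Cross (toℕ fi) (toℕ fj) k l →
                         FinView n k → FinView n l →
                         T (∃Fin λ fk → ∃Fin λ fl → mem S fk fl ∧ P.cross fi fj fk fl)
      crossing-witness r c (fk , refl) (fl , refl) =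
        from T-∃Fin (fk , from T-∃Fin (fl , from (T-∧ {mem S fk fl}) (from mem⇔ r , from T-cross c)))

      completion : Maximal R → ∀ {fi fj} → T (P.diagonal fi fj) →
                   T (mem S fi fj) ⊎ T (∃Fin λ fk → ∃Fin λ fl → mem S fk fl ∧ P.cross fi fj fk fl)
      completion f {fi} {fj} d with T? (mem S fi fj)
      ... | yes m = inj₁ m
      ... | no ¬m = let _ , _ , r , c = f (toℕ<n fj) (to T-diagonal d) (¬m ∘ from mem⇔)
                        k<n , l<n = bounded r
                    in inj₂ (crossing-witness r c (finView k<n) (finView l<n))

    T-isTriangulation : T (P.isTriangulation S) ⇔ IsTriangulation R
    T-isTriangulation = mk⇔
      (λ t → let d , rest = to (T-∧ {P.onlyDiagonals S}) t ; c , m = to (T-∧ {P.nonCrossing S}) rest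
             in record { isNonCrossing = record { diagonal    = to T-onlyDiagonals d
                                                ; nonCrossing = to T-nonCrossing c }
                       ; maximal       = to T-maximal m })
      (λ tri → from (T-∧ {P.onlyDiagonals S})
                 (from T-onlyDiagonals (IsTriangulation.diagonal tri) ,
                  from (T-∧ {P.nonCrossing S}) (from T-nonCrossing (IsTriangulation.nonCrossing tri) ,
                                                from T-maximal (IsTriangulation.maximal tri))))

    -- `P.colorful` compares colours by a where-bound function that cannot be named here;
    -- abstracting over the colours (and the triangle test) lets it compute.
    T-colorful : ∀ {colour} → T (P.colorful (colour ∘ toℕ) S) ⇔ Colorful colour R
    T-colorful {colour} = mk⇔ colorful⇒ colorful⇐
      where
      monochromatic-at : T (P.colorful (colour ∘ toℕ) S) → ∀ {i j k} → T (P.triangle S i j k) →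
                         colour (toℕ i) ≡ colour (toℕ j) → colour (toℕ j) ≡ colour (toℕ k) → ⊥
      monochromatic-at h {i} {j} {k} t
        with P.triangle S i j k | t | colour (toℕ i) | colour (toℕ j) | colour (toℕ k)
           | to (T-∀Fin {n}) (to (T-∀Fin {n}) (to (T-∀Fin {n}) h i) j) k
      ... | true | _ | true  | true  | true  | ()
      ... | true | _ | false | false | false | ()
      ... | true | _ | true  | false | _     | _ = λ ()
      ... | true | _ | false | true  | _     | _ = λ ()
      ... | true | _ | true  | true  | false | _ = λ _ ()
      ... | true | _ | false | false | true  | _ = λ _ ()

      colorful⇒ : T (P.colorful (colour ∘ toℕ) S) → Colorful colour R
      colorful⇒ h tri@(i<j , j<k , k<n , _) =
        at (finView (<-trans i<j (<-trans j<k k<n))) (finView (<-trans j<k k<n)) (finView k<n) tri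
        where
        at : ∀ {i j k} → FinView n i → FinView n j → FinView n k → Triangle R i j k →
             colour i ≡ colour j → colour j ≡ colour k → ⊥
        at (fi , refl) (fj , refl) (fk , refl) tri = monochromatic-at h (from T-triangle tri)

      colorful⇐ : Colorful colour R → T (P.colorful (colour ∘ toℕ) S)
      colorful⇐ colorful = decidable-stable (T? _) ¬¬colorful
        where
        monochromatic : ∀ {fi fj fk} → P.triangle S fi fj fk ≡ true →
                        colour (toℕ fi) ≡ colour (toℕ fj) → colour (toℕ fj) ≡ colour (toℕ fk) → ⊥
        monochromatic t = colorful (to T-triangle (subst T (sym t) tt))

        ¬¬colorful : ¬ ¬ T (P.colorful (colour ∘ toℕ) S)
        ¬¬colorful ¬h
          with fi , ¬h₁ ← ¬T-∀Fin ¬h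
          with fj , ¬h₂ ← ¬T-∀Fin ¬h₁
          with fk , ¬b ← ¬T-∀Fin ¬h₂
          with P.triangle S fi fj fk in t | colour (toℕ fi) in ci | colour (toℕ fj) in cj
             | colour (toℕ fk) in ck | ¬b
        ... | false | _     | _     | _     | ¬b = ¬b tt
        ... | true  | true  | true  | true  | _  = monochromatic t (trans ci (sym cj)) (trans cj (sym ck))
        ... | true  | false | false | false | _  = monochromatic t (trans ci (sym cj)) (trans cj (sym ck))
        ... | true  | true  | true  | false | ¬b = ¬b tt
        ... | true  | true  | false | _     | ¬b = ¬b tt
        ... | true  | false | true  | _     | ¬b = ¬b tt
        ... | true  | false | false | true  | ¬b = ¬b tt

  module _ {S S′ R R′} (S≈R : Represents S R) (S′≈R′ : Represents S′ R′) where
    open Represents S≈R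
    open Represents S′≈R′ renaming (mem⇔ to mem⇔′; bounded to bounded′)

    agreement⇒kept : ∀ {i j k l} → ¬ T (mem S k l) →
                     (∀ x y → ¬ (x ≡ i × y ≡ j) → ¬ (x ≡ k × y ≡ l) → mem S x y ≡ mem S′ x y) →
                     R ⇒ λ u v → R′ u v ⊎ (u ≡ toℕ i × v ≡ toℕ j)
    agreement⇒kept {i} {j} {k} {l} kl∉S agree r =
      at (finView (proj₁ (bounded r))) (finView (proj₂ (bounded r))) r
      where
      at : ∀ {u v} → FinView n u → FinView n v → R u v → R′ u v ⊎ (u ≡ toℕ i × v ≡ toℕ j)
      at (x , refl) (y , refl) r with (x Fin.≟ i) ×-dec (y Fin.≟ j)
      ... | yes (refl , refl) = inj₂ (refl , refl)
      ... | no ¬ij with (x Fin.≟ k) ×-dec (y Fin.≟ l)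
      ...   | yes (refl , refl) = ⊥-elim (kl∉S (from mem⇔ r))
      ...   | no ¬kl = inj₁ (to mem⇔′ (subst T (agree x y ¬ij ¬kl) (from mem⇔ r)))

    kept⇒agreement : ∀ {i j} → (R ⇒ λ u v → R′ u v ⊎ (u ≡ toℕ i × v ≡ toℕ j)) →
                     ∀ {x y} → ¬ (x ≡ i × y ≡ j) → T (mem S x y) → T (mem S′ x y)
    kept⇒agreement kept ¬ij m with kept (to mem⇔ m)
    ... | inj₁ r′ = from mem⇔′ r′
    ... | inj₂ (x≡i , y≡j) = ⊥-elim (¬ij (toℕ-injective x≡i , toℕ-injective y≡j))

  Flip⇔ : ∀ {S S′ R R′} → Represents S R → Represents S′ R′ → IsNonCrossing R → IsNonCrossing R′ →
          P.Flip S S′ ⇔ Flip R R′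
  Flip⇔ {S} {S′} {R} {R′} S≈R S′≈R′ R-nc R′-nc = mk⇔ flip⇒ flip⇐
    where
    open Represents S≈R
    open Represents S′≈R′ renaming (mem⇔ to mem⇔′; bounded to bounded′)
    open IsNonCrossing R-nc
    open IsNonCrossing R′-nc renaming (nonCrossing to nonCrossing′)

    flip⇒ : P.Flip S S′ → Flip R R′
    flip⇒ (i , j , k , l , ij∈S , ij∉S′ , kl∈S′ , kl∉S , c , agree) = record
      { I = toℕ i ; J = toℕ j ; K = toℕ k ; L = toℕ l
      ; removed  = to mem⇔ ij∈S
      ; added    = to mem⇔′ kl∈S′
      ; crossing = to T-cross c
      ; kept     = agreement⇒kept S≈R S′≈R′ (to T-not kl∉S) agree
      ; kept′    = agreement⇒kept S′≈R′ S≈R (to T-not ij∉S′) λ x y ¬kl ¬ij → sym (agree x y ¬ij ¬kl)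
      }

    flip⇐ : Flip R R′ → P.Flip S S′
    flip⇐ record { removed = IJ ; added = KL ; crossing = c ; kept = kept ; kept′ = kept′ }
      with (i , refl) ← finView (proj₁ (bounded IJ)) | (j , refl) ← finView (proj₂ (bounded IJ))
         | (k , refl) ← finView (proj₁ (bounded′ KL)) | (l , refl) ← finView (proj₂ (bounded′ KL))
      = i , j , k , l
      , from mem⇔ IJ , from T-not (λ m → nonCrossing′ (to mem⇔′ m) KL c)
      , from mem⇔′ KL , from T-not (λ m → nonCrossing IJ (to mem⇔ m) c)
      , from T-cross c
      , λ x y ¬ij ¬kl → T-injective (mk⇔ (kept⇒agreement S≈R S′≈R′ kept ¬ij)
                                         (kept⇒agreement S′≈R′ S≈R kept′ ¬kl))

  module _ {S R} (S≈R : Represents S R) where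

    T-vertex : ∀ {colour} → T (P.isTriangulation S ∧ P.colorful (colour ∘ toℕ) S) ⇔
                            (IsTriangulation R × Colorful colour R)
    T-vertex = (T-isTriangulation S≈R ×-⇔ T-colorful S≈R) ⇔-∘ T-∧ {P.isTriangulation S}

  Represents-cong : ∀ {S R R′} → Represents S R → (∀ {i j} → R i j ⇔ R′ i j) → Represents S R′
  Represents-cong S≈R R⇔R′ = record
    { mem⇔    = R⇔R′ ⇔-∘ Represents.mem⇔ S≈R
    ; bounded = Represents.bounded S≈R ∘ from R⇔R′
    }

  Represents-⇒ : ∀ {S R R′} → Represents S R → Represents S R′ → R ⇒ R′
  Represents-⇒ {S} {R} {R′} S≈R S≈R′ r = at (finView (proj₁ (bounded r))) (finView (proj₂ (bounded r))) r
    where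
    open Represents S≈R
    at : ∀ {i j} → FinView n i → FinView n j → R i j → R′ i j
    at (fi , refl) (fj , refl) r = to (Represents.mem⇔ S≈R′) (from mem⇔ r)

  Member : DiagSet n → Rel ℕ 0ℓ
  Member S i j = Σ (i < n) λ i<n → Σ (j < n) λ j<n → T (mem S (fromℕ< i<n) (fromℕ< j<n))

  Member? : ∀ S → Decidable (Member S)
  Member? S i j with i <? n | j <? n
  ... | yes i<n | yes j<n = map′ (λ m → i<n , j<n , m) (proj₂ ∘ proj₂) (T? (mem S (fromℕ< i<n) (fromℕ< j<n)))
  ... | no i≮n  | _       = no (i≮n ∘ proj₁)
  ... | yes _   | no j≮n  = no (j≮n ∘ proj₁ ∘ proj₂)

  Member-represents : ∀ S → Represents S (Member S)
  Member-represents S = record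
    { mem⇔    = λ {i} {j} → mk⇔
        (λ m → toℕ<n i , toℕ<n j , subst₂ (λ x y → T (mem S x y)) (sym (fromℕ<-toℕ i _)) (sym (fromℕ<-toℕ j _)) m)
        (λ (i<n , j<n , m) → subst₂ (λ x y → T (mem S x y)) (fromℕ<-toℕ i i<n) (fromℕ<-toℕ j j<n) m)
    ; bounded = λ (i<n , j<n , _) → i<n , j<n
    }

  matrix : ∀ {R : Rel ℕ 0ℓ} → Decidable R → DiagSet n
  matrix R? = tabulate λ i → tabulate λ j → ⌊ R? (toℕ i) (toℕ j) ⌋

  matrix-represents : ∀ {R : Rel ℕ 0ℓ} (R? : Decidable R) → (∀ {i j} → R i j → i < n × j < n) →
                      Represents (matrix R?) R
  matrix-represents R? bounded = record
    { mem⇔    = λ {i} {j} → subst (λ b → T b ⇔ _) (sym (mem-matrix i j)) T-isYes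
    ; bounded = bounded
    }
    where
    mem-matrix : ∀ i j → mem (matrix R?) i j ≡ ⌊ R? (toℕ i) (toℕ j) ⌋
    mem-matrix i j = trans (cong (λ row → lookup row j) (lookup∘tabulate _ i)) (lookup∘tabulate _ j)

  Represents-unique : ∀ {S S′ R} → Represents S R → Represents S′ R → S ≡ S′
  Represents-unique {S} {S′} S≈R S′≈R = begin
    S                                            ≡⟨ tabulate² S ⟨
    tabulate (λ i → tabulate (λ j → mem S i j))   ≡⟨ tabulate-cong (λ i → tabulate-cong (same-entry i)) ⟩
    tabulate (λ i → tabulate (λ j → mem S′ i j))  ≡⟨ tabulate² S′ ⟩
    S′                                           ∎
    where
    open ≡-Reasoning
    tabulate² : ∀ M → tabulate (λ i → tabulate (λ j → mem M i j)) ≡ M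
    tabulate² M = trans (tabulate-cong (λ i → tabulate∘lookup (lookup M i))) (tabulate∘lookup M)
    same-entry : ∀ i j → mem S i j ≡ mem S′ i j
    same-entry i j = T-injective (⇔-sym (Represents.mem⇔ S′≈R) ⇔-∘ Represents.mem⇔ S≈R)

module Coloured (a b : ℕ) where

  n : ℕ
  n = a + b + 2

  Q : ℕ
  Q = suc (a + b)

  open ConvexPolygon n

  1+Q≡n : suc Q ≡ n
  1+Q≡n = +-comm 2 (a + b)

  a<Q : a < Q
  a<Q = s≤s (m≤m+n a b)

  Q<n : Q < n
  Q<n = subst (Q <_) 1+Q≡n (n<1+n Q)

  <n⇒≤Q : ∀ {j} → j < n → j ≤ Q
  <n⇒≤Q {j} j<n = s≤s⁻¹ (subst (suc j ≤_) (sym 1+Q≡n) j<n)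

  Diagonal-intro : ∀ {i j} → suc i < j → 0 < i ⊎ j < Q → Diagonal i j
  Diagonal-intro 1+i<j inner = <-trans (n<1+n _) 1+i<j , λ
    { (inj₁ 1+i≡j) → <-irrefl 1+i≡j 1+i<j
    ; (inj₂ (refl , 1+j≡n)) → wraps inner (suc-injective (trans 1+j≡n (sym 1+Q≡n)))
    }
    where
    wraps : ∀ {j} → 0 < 0 ⊎ j < Q → j ≢ Q
    wraps (inj₂ j<Q) refl = <-irrefl refl j<Q

  Diagonal-to-Q⇒1≤i : ∀ {i} → Diagonal i Q → 1 ≤ i
  Diagonal-to-Q⇒1≤i {zero} (_ , ¬side) = contradiction (inj₂ (refl , 1+Q≡n)) ¬side
  Diagonal-to-Q⇒1≤i {suc i} _ = s≤s z≤n

  isBlue : ℕ → Bool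
  isBlue i = (i == a) ∨ (i == (a + b + 1))

  Blue : ℕ → Set
  Blue i = i ≡ a ⊎ i ≡ Q

  T-isBlue : ∀ {i} → T (isBlue i) ⇔ Blue i
  T-isBlue {i} = (T-isYes ⊎-⇔ subst (λ q → T (i == (a + b + 1)) ⇔ (i ≡ q)) (+-comm (a + b) 1) T-isYes)
                 ⇔-∘ T-∨ {i == a}

  -- The standard triangulation T(X,Y,t), for X in A = {0..a-1} and Y in B = {a+1..a+b}:
  -- fans from Q to 1..X, from a to X..a-2, from a to a+2..Y and from Q to Y..Q-2, and
  -- the quadrilateral X a Y Q cut by {a,Q} (t = false) or by {X,Y} (t = true).
  Std : ℕ → ℕ → Bool → Rel ℕ 0ℓ
  Std X Y t i j = (1 ≤ i × i ≤ X × j ≡ Q)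
                ⊎ (X ≤ i × suc i < a × j ≡ a)
                ⊎ (i ≡ a × suc a < j × j ≤ Y)
                ⊎ (Y ≤ i × suc i < Q × j ≡ Q)
                ⊎ (t ≡ false × i ≡ a × j ≡ Q)
                ⊎ (t ≡ true × i ≡ X × j ≡ Y)

  pattern QA p q r = inj₁ (p , q , r)
  pattern aA p q r = inj₂ (inj₁ (p , q , r))
  pattern aB p q r = inj₂ (inj₂ (inj₁ (p , q , r)))
  pattern QB p q r = inj₂ (inj₂ (inj₂ (inj₁ (p , q , r))))
  pattern aQ p q r = inj₂ (inj₂ (inj₂ (inj₂ (inj₁ (p , q , r)))))
  pattern XY p q r = inj₂ (inj₂ (inj₂ (inj₂ (inj₂ (p , q , r)))))

  Std? : ∀ X Y t → Decidable (Std X Y t)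
  Std? X Y t i j = ((1 ≤? i) ×-dec (i ≤? X) ×-dec (j ≟ Q))
                 ⊎-dec ((X ≤? i) ×-dec (suc i <? a) ×-dec (j ≟ a))
                 ⊎-dec ((i ≟ a) ×-dec (suc a <? j) ×-dec (j ≤? Y))
                 ⊎-dec ((Y ≤? i) ×-dec (suc i <? Q) ×-dec (j ≟ Q))
                 ⊎-dec ((t ≟ᵇ false) ×-dec (i ≟ a) ×-dec (j ≟ Q))
                 ⊎-dec ((t ≟ᵇ true) ×-dec (i ≟ X) ×-dec (j ≟ Y))

  module Standard {X Y : ℕ} (X<a : X < a) (a<Y : a < Y) (Y<Q : Y < Q) where

    X<Y : X < Y
    X<Y = <-trans X<a a<Y

    1+a<Q : suc a < Q
    1+a<Q = ≤-<-trans a<Y Y<Q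

    Std-diagonal : ∀ {t i j} → Std X Y t i j → Diagonal i j × j < n
    Std-diagonal (QA 1≤i i≤X refl) = Diagonal-intro (≤-<-trans (s≤s i≤X) (≤-<-trans X<a a<Q)) (inj₁ 1≤i) , Q<n
    Std-diagonal (aA _ 1+i<a refl) = Diagonal-intro 1+i<a (inj₂ a<Q) , <-trans a<Q Q<n
    Std-diagonal (aB refl 1+a<j j≤Y) =
      Diagonal-intro 1+a<j (inj₂ (≤-<-trans j≤Y Y<Q)) , <-trans (≤-<-trans j≤Y Y<Q) Q<n
    Std-diagonal (QB Y≤i 1+i<Q refl) = Diagonal-intro 1+i<Q (inj₁ (<-≤-trans (≤-<-trans z≤n a<Y) Y≤i)) , Q<n
    Std-diagonal (aQ _ refl refl) = Diagonal-intro 1+a<Q (inj₁ (≤-<-trans z≤n X<a)) , Q<n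
    Std-diagonal (XY _ refl refl) = Diagonal-intro (≤-<-trans X<a a<Y) (inj₂ Y<Q) , <-trans Y<Q Q<n

    ¬Cross-XY : ∀ {t k l} → t ≡ true → Std X Y t k l → ¬ Cross X Y k l
    ¬Cross-XY _ (QA _ k≤X refl) (inj₁ (X<k , _)) = <⇒≱ X<k k≤X
    ¬Cross-XY _ (QA _ _ refl) (inj₂ (_ , _ , Q<Y)) = <-asym Q<Y Y<Q
    ¬Cross-XY _ (aA _ _ refl) (inj₁ (_ , _ , Y<a)) = <-asym Y<a a<Y
    ¬Cross-XY _ (aA X≤k _ refl) (inj₂ (k<X , _)) = <⇒≱ k<X X≤k
    ¬Cross-XY _ (aB refl _ l≤Y) (inj₁ (_ , _ , Y<l)) = <⇒≱ Y<l l≤Y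
    ¬Cross-XY _ (aB refl _ _) (inj₂ (a<X , _)) = <-asym a<X X<a
    ¬Cross-XY _ (QB Y≤k _ refl) (inj₁ (_ , k<Y , _)) = <⇒≱ k<Y Y≤k
    ¬Cross-XY _ (QB Y≤k _ refl) (inj₂ (k<X , _)) = <⇒≱ (<-trans k<X X<Y) Y≤k
    ¬Cross-XY refl (aQ () _ _)
    ¬Cross-XY _ (XY _ refl refl) = ¬Cross-from-same

    ¬Cross-aQ : ∀ {t k l} → t ≡ false → Std X Y t k l → ¬ Cross a Q k l
    ¬Cross-aQ _ (QA _ _ refl) = ¬Cross-to-same
    ¬Cross-aQ _ (aA _ _ refl) = ¬Cross-end-to-start ∘ Cross-sym
    ¬Cross-aQ _ (aB refl _ _) = ¬Cross-from-same
    ¬Cross-aQ _ (QB _ _ refl) = ¬Cross-to-same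
    ¬Cross-aQ _ (aQ _ refl refl) = ¬Cross-from-same
    ¬Cross-aQ refl (XY () _ _)

    ¬Cross-QA : ∀ {t i k l} → 1 ≤ i → i ≤ X → Std X Y t k l → ¬ Cross i Q k l
    ¬Cross-QA _ _ (QA _ _ refl) = ¬Cross-to-same
    ¬Cross-QA _ _ (aA _ _ refl) (inj₁ (_ , _ , Q<a)) = <-asym Q<a a<Q
    ¬Cross-QA _ i≤X (aA X≤k _ refl) (inj₂ (k<i , _)) = <⇒≱ k<i (≤-trans i≤X X≤k)
    ¬Cross-QA _ _ (aB refl _ l≤Y) (inj₁ (_ , _ , Q<l)) = <⇒≱ (<-trans Y<Q Q<l) l≤Y
    ¬Cross-QA _ i≤X (aB refl _ _) (inj₂ (a<i , _)) = <⇒≱ (≤-<-trans i≤X X<a) (<⇒≤ a<i)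
    ¬Cross-QA _ _ (QB _ _ refl) = ¬Cross-to-same
    ¬Cross-QA _ _ (aQ _ refl refl) = ¬Cross-to-same
    ¬Cross-QA 1≤i i≤X (XY t refl refl) = ¬Cross-XY t (QA 1≤i i≤X refl) ∘ Cross-sym

    ¬Cross-QB : ∀ {t i k l} → Y ≤ i → suc i < Q → Std X Y t k l → ¬ Cross i Q k l
    ¬Cross-QB _ _ (QA _ _ refl) = ¬Cross-to-same
    ¬Cross-QB Y≤i _ (aA _ 1+k<a refl) (inj₁ (i<k , _)) =
      <⇒≱ (<-trans i<k (<-trans (n<1+n _) 1+k<a)) (≤-trans (<⇒≤ a<Y) Y≤i)
    ¬Cross-QB Y≤i _ (aA _ _ refl) (inj₂ (_ , i<a , _)) = <⇒≱ i<a (≤-trans (<⇒≤ a<Y) Y≤i)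
    ¬Cross-QB Y≤i _ (aB refl _ _) (inj₁ (i<a , _)) = <⇒≱ i<a (≤-trans (<⇒≤ a<Y) Y≤i)
    ¬Cross-QB Y≤i _ (aB refl _ l≤Y) (inj₂ (_ , i<l , _)) = <⇒≱ i<l (≤-trans l≤Y Y≤i)
    ¬Cross-QB _ _ (QB _ _ refl) = ¬Cross-to-same
    ¬Cross-QB _ _ (aQ _ refl refl) = ¬Cross-to-same
    ¬Cross-QB Y≤i 1+i<Q (XY t refl refl) = ¬Cross-XY t (QB Y≤i 1+i<Q refl) ∘ Cross-sym

    ¬Cross-aA : ∀ {t i k l} → X ≤ i → suc i < a → Std X Y t k l → ¬ Cross i a k l
    ¬Cross-aA {t} X≤i 1+i<a (QA 1≤k k≤X refl) = ¬Cross-QA {t} 1≤k k≤X (aA X≤i 1+i<a refl) ∘ Cross-sym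
    ¬Cross-aA _ _ (aA _ _ refl) = ¬Cross-to-same
    ¬Cross-aA _ _ (aB refl _ _) = ¬Cross-end-to-start
    ¬Cross-aA {t} X≤i 1+i<a (QB Y≤k 1+k<Q refl) = ¬Cross-QB {t} Y≤k 1+k<Q (aA X≤i 1+i<a refl) ∘ Cross-sym
    ¬Cross-aA X≤i 1+i<a (aQ t refl refl) = ¬Cross-aQ t (aA X≤i 1+i<a refl) ∘ Cross-sym
    ¬Cross-aA X≤i 1+i<a (XY t refl refl) = ¬Cross-XY t (aA X≤i 1+i<a refl) ∘ Cross-sym

    ¬Cross-aB : ∀ {t j k l} → suc a < j → j ≤ Y → Std X Y t k l → ¬ Cross a j k l
    ¬Cross-aB {t} 1+a<j j≤Y (QA 1≤k k≤X refl) = ¬Cross-QA {t} 1≤k k≤X (aB refl 1+a<j j≤Y) ∘ Cross-sym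
    ¬Cross-aB {t} 1+a<j j≤Y (aA X≤k 1+k<a refl) = ¬Cross-aA {t} X≤k 1+k<a (aB refl 1+a<j j≤Y) ∘ Cross-sym
    ¬Cross-aB _ _ (aB refl _ _) = ¬Cross-from-same
    ¬Cross-aB {t} 1+a<j j≤Y (QB Y≤k 1+k<Q refl) = ¬Cross-QB {t} Y≤k 1+k<Q (aB refl 1+a<j j≤Y) ∘ Cross-sym
    ¬Cross-aB _ _ (aQ _ refl refl) = ¬Cross-from-same
    ¬Cross-aB 1+a<j j≤Y (XY t refl refl) = ¬Cross-XY t (aB refl 1+a<j j≤Y) ∘ Cross-sym

    Std-nonCrossing : ∀ {t i j k l} → Std X Y t i j → Std X Y t k l → ¬ Cross i j k l
    Std-nonCrossing (QA 1≤i i≤X refl) = ¬Cross-QA 1≤i i≤X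
    Std-nonCrossing (aA X≤i 1+i<a refl) = ¬Cross-aA X≤i 1+i<a
    Std-nonCrossing (aB refl 1+a<j j≤Y) = ¬Cross-aB 1+a<j j≤Y
    Std-nonCrossing (QB Y≤i 1+i<Q refl) = ¬Cross-QB Y≤i 1+i<Q
    Std-nonCrossing (aQ t refl refl) = ¬Cross-aQ t
    Std-nonCrossing (XY t refl refl) = ¬Cross-XY t

    Crossed : Bool → ℕ → ℕ → Set
    Crossed t i j = ∃₂ λ k l → Std X Y t k l × Cross i j k l

    crossed-inside-A : ∀ {t i j} → suc i < j → j < a → Crossed t i j
    crossed-inside-A {i = i} {j} 1+i<j j<a with X ≤? i
    ... | yes X≤i =
      suc i , a , aA (≤-trans X≤i (n≤1+n i)) (≤-<-trans 1+i<j j<a) refl , inj₁ (n<1+n i , 1+i<j , j<a)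
    ... | no X≰i with X <? j
    ...   | yes X<j = X , a , aA ≤-refl (≤-<-trans X<j j<a) refl , inj₁ (≰⇒> X≰i , X<j , j<a)
    ...   | no X≮j =
      suc i , Q , QA (s≤s z≤n) (≤-trans (<⇒≤ 1+i<j) (≮⇒≥ X≮j)) refl , inj₁ (n<1+n i , 1+i<j , <-trans j<a a<Q)

    crossed-at-a : ∀ {t i} → suc i < a → ¬ Std X Y t i a → Crossed t i a
    crossed-at-a {i = i} 1+i<a ¬std with X ≤? i
    ... | yes X≤i = ⊥-elim (¬std (aA X≤i 1+i<a refl))
    ... | no X≰i = X , Q , QA (≤-<-trans z≤n (≰⇒> X≰i)) ≤-refl refl , inj₁ (≰⇒> X≰i , X<a , a<Q)

    crossed-inside-B : ∀ {t i j} → suc i < j → a < j → j < Q → ¬ Std X Y t i j → Crossed t i j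
    crossed-inside-B {t} {i} {j} 1+i<j a<j j<Q ¬std with <-cmp i a | t
    ... | tri< i<a _ _ | false = a , Q , aQ refl refl refl , inj₁ (i<a , a<j , j<Q)
    ... | tri< i<a _ _ | true with <-cmp i X
    ...   | tri< i<X _ _ = X , Q , QA (≤-<-trans z≤n i<X) ≤-refl refl , inj₁ (i<X , <-trans X<a a<j , j<Q)
    ...   | tri> _ _ X<i = X , a , aA ≤-refl (≤-<-trans X<i i<a) refl , inj₂ (X<i , i<a , a<j)
    ...   | tri≈ _ refl _ with <-cmp j Y
    ...     | tri< j<Y _ _ = a , Y , aB refl (≤-<-trans a<j j<Y) ≤-refl , inj₁ (X<a , a<j , j<Y)
    ...     | tri≈ _ refl _ = ⊥-elim (¬std (XY refl refl refl))
    ...     | tri> _ _ Y<j = Y , Q , QB ≤-refl (≤-<-trans Y<j j<Q) refl , inj₁ (X<Y , Y<j , j<Q)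
    crossed-inside-B {t} {i} {j} 1+i<j a<j j<Q ¬std | tri≈ _ refl _ | _ with Y <? j
    ... | yes Y<j = Y , Q , QB ≤-refl (≤-<-trans Y<j j<Q) refl , inj₁ (a<Y , Y<j , j<Q)
    ... | no Y≮j = ⊥-elim (¬std (aB refl 1+i<j (≮⇒≥ Y≮j)))
    crossed-inside-B {t} {i} {j} 1+i<j a<j j<Q ¬std | tri> _ _ a<i | _ with j ≤? Y
    ... | yes j≤Y = a , suc i , aB refl (s≤s a<i) (≤-trans (<⇒≤ 1+i<j) j≤Y) , inj₂ (a<i , n<1+n i , 1+i<j)
    ... | no j≰Y with i <? Y
    ...   | yes i<Y = Y , Q , QB ≤-refl (≤-<-trans (≰⇒> j≰Y) j<Q) refl , inj₁ (i<Y , ≰⇒> j≰Y , j<Q)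
    ...   | no i≮Y =
      suc i , Q , QB (≤-trans (≮⇒≥ i≮Y) (n≤1+n i)) (≤-<-trans 1+i<j j<Q) refl , inj₁ (n<1+n i , 1+i<j , j<Q)

    crossed-at-Q : ∀ {t i} → 1 ≤ i → suc i < Q → ¬ Std X Y t i Q → Crossed t i Q
    crossed-at-Q {t} {i} 1≤i 1+i<Q ¬std with <-cmp i a | t
    ... | tri< i<a _ _ | _ with i ≤? X
    ...   | yes i≤X = ⊥-elim (¬std (QA 1≤i i≤X refl))
    ...   | no i≰X = X , a , aA ≤-refl (≤-<-trans (≰⇒> i≰X) i<a) refl , inj₂ (≰⇒> i≰X , i<a , a<Q)
    crossed-at-Q 1≤i 1+i<Q ¬std | tri≈ _ refl _ | false = ⊥-elim (¬std (aQ refl refl refl))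
    crossed-at-Q 1≤i 1+i<Q ¬std | tri≈ _ refl _ | true = X , Y , XY refl refl refl , inj₂ (X<a , a<Y , Y<Q)
    crossed-at-Q {i = i} 1≤i 1+i<Q ¬std | tri> _ _ a<i | _ with i <? Y
    ...   | yes i<Y = a , Y , aB refl (≤-<-trans a<i i<Y) ≤-refl , inj₂ (a<i , i<Y , Y<Q)
    ...   | no i≮Y = ⊥-elim (¬std (QB (≮⇒≥ i≮Y) 1+i<Q refl))

    Std-maximal : ∀ {t i j} → j < n → Diagonal i j → ¬ Std X Y t i j → Crossed t i j
    Std-maximal {j = j} j<n d ¬std with <-cmp j a
    ... | tri< j<a _ _ = crossed-inside-A (Diagonal⇒1+i<j d) j<a
    ... | tri≈ _ refl _ = crossed-at-a (Diagonal⇒1+i<j d) ¬std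
    ... | tri> _ _ a<j with <-cmp j Q
    ...   | tri< j<Q _ _ = crossed-inside-B (Diagonal⇒1+i<j d) a<j j<Q ¬std
    ...   | tri≈ _ refl _ = crossed-at-Q (Diagonal-to-Q⇒1≤i d) (Diagonal⇒1+i<j d) ¬std
    ...   | tri> _ _ Q<j = contradiction (<n⇒≤Q j<n) (<⇒≱ Q<j)

    private
      three-blue : ∀ {i j k} → i < j → j < k → k < n → Blue i → Blue j → Blue k → ⊥
      three-blue i<j _ _ (inj₁ refl) (inj₁ refl) _ = <-irrefl refl i<j
      three-blue i<j _ _ (inj₂ refl) (inj₁ refl) _ = <-asym i<j a<Q
      three-blue _ j<k _ _ (inj₂ refl) (inj₁ refl) = <-asym j<k a<Q
      three-blue _ j<k _ _ (inj₂ refl) (inj₂ refl) = <-irrefl refl j<k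

      red-edge : ∀ {t i j} → ¬ Blue i → ¬ Blue j → Edge (Std X Y t) i j → suc i ≡ j ⊎ (t ≡ true × i ≡ X × j ≡ Y)
      red-edge _ _ (inj₁ (inj₁ 1+i≡j)) = inj₁ 1+i≡j
      red-edge _ ¬bj (inj₁ (inj₂ (_ , 1+j≡n))) = ⊥-elim (¬bj (inj₂ (suc-injective (trans 1+j≡n (sym 1+Q≡n)))))
      red-edge _ ¬bj (inj₂ (QA _ _ refl)) = ⊥-elim (¬bj (inj₂ refl))
      red-edge _ ¬bj (inj₂ (aA _ _ refl)) = ⊥-elim (¬bj (inj₁ refl))
      red-edge ¬bi _ (inj₂ (aB refl _ _)) = ⊥-elim (¬bi (inj₁ refl))
      red-edge _ ¬bj (inj₂ (QB _ _ refl)) = ⊥-elim (¬bj (inj₂ refl))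
      red-edge ¬bi _ (inj₂ (aQ _ refl _)) = ⊥-elim (¬bi (inj₁ refl))
      red-edge _ _ (inj₂ (XY t i≡X j≡Y)) = inj₂ (t , i≡X , j≡Y)

      -- Only {X,Y} joins two red points that are not neighbours, so a red triangle would be
      -- X, X+1, X+2 = Y, leaving no room for the blue a.
      three-red : ∀ {t i j k} → Triangle (Std X Y t) i j k → ¬ Blue i → ¬ Blue j → ¬ Blue k → ⊥
      three-red (i<j , j<k , _ , ij , jk , ik) ¬bi ¬bj ¬bk with red-edge ¬bi ¬bk ik
      ... | inj₁ refl = <⇒≱ i<j (s≤s⁻¹ j<k)
      ... | inj₂ (_ , refl , refl) with red-edge ¬bi ¬bj ij | red-edge ¬bj ¬bk jk
      ...   | inj₂ (_ , _ , refl) | _ = <-irrefl refl j<k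
      ...   | inj₁ _ | inj₂ (_ , refl , _) = <-irrefl refl i<j
      ...   | inj₁ refl | inj₁ refl = ¬bj (inj₁ (≤-antisym X<a (s≤s⁻¹ a<Y)))

    Std-colorful : ∀ {t} → Colorful isBlue (Std X Y t)
    Std-colorful {i = i} {j} {k} tri@(i<j , j<k , k<n , _) ci≡cj cj≡ck with isBlue i in ci
    ... | true  = three-blue i<j j<k k<n (blue-of ci) (blue-of (sym ci≡cj)) (blue-of (trans (sym cj≡ck) (sym ci≡cj)))
      where blue-of : ∀ {x} → isBlue x ≡ true → Blue x
            blue-of e = to T-isBlue (subst T (sym e) _)
    ... | false = three-red tri (red-of ci) (red-of (sym ci≡cj)) (red-of (trans (sym cj≡ck) (sym ci≡cj)))
      where red-of : ∀ {x} → isBlue x ≡ false → ¬ Blue x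
            red-of e = subst T e ∘ from T-isBlue

    Std-isNonCrossing : ∀ {t} → IsNonCrossing (Std X Y t)
    Std-isNonCrossing = record { diagonal = Std-diagonal ; nonCrossing = Std-nonCrossing }

    Std-isTriangulation : ∀ {t} → IsTriangulation (Std X Y t)
    Std-isTriangulation = record { isNonCrossing = Std-isNonCrossing ; maximal = Std-maximal }

    Std-bounded : ∀ {t i j} → Std X Y t i j → i < n × j < n
    Std-bounded s = let (i<j , _) , j<n = Std-diagonal s in <-trans i<j j<n , j<n

    ¬Std-A-Q : ∀ {t u} → X < u → u < a → ¬ Std X Y t u Q
    ¬Std-A-Q X<u _ (QA _ u≤X _) = <⇒≱ X<u u≤X
    ¬Std-A-Q _ _ (aA _ _ Q≡a) = <-irrefl (sym Q≡a) a<Q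
    ¬Std-A-Q _ u<a (aB refl _ _) = <-irrefl refl u<a
    ¬Std-A-Q _ u<a (QB Y≤u _ _) = <⇒≱ (<-trans u<a a<Y) Y≤u
    ¬Std-A-Q _ u<a (aQ _ refl _) = <-irrefl refl u<a
    ¬Std-A-Q X<u _ (XY _ refl _) = <-irrefl refl X<u

    ¬Std-A-a : ∀ {t u} → u < X → ¬ Std X Y t u a
    ¬Std-A-a _ (QA _ _ a≡Q) = <-irrefl a≡Q a<Q
    ¬Std-A-a u<X (aA X≤u _ _) = <⇒≱ u<X X≤u
    ¬Std-A-a _ (aB refl 1+a<a _) = <-asym 1+a<a (n<1+n _)
    ¬Std-A-a _ (QB _ _ a≡Q) = <-irrefl a≡Q a<Q
    ¬Std-A-a _ (aQ _ _ a≡Q) = <-irrefl a≡Q a<Q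
    ¬Std-A-a _ (XY _ _ a≡Y) = <-irrefl a≡Y a<Y

    ¬Std-a-B : ∀ {t v} → Y < v → v < Q → ¬ Std X Y t a v
    ¬Std-a-B _ _ (QA _ a≤X _) = <⇒≱ X<a a≤X
    ¬Std-a-B _ _ (aA _ 1+a<a _) = <-asym 1+a<a (n<1+n _)
    ¬Std-a-B Y<v _ (aB _ _ v≤Y) = <⇒≱ Y<v v≤Y
    ¬Std-a-B _ _ (QB Y≤a _ _) = <⇒≱ a<Y Y≤a
    ¬Std-a-B _ v<Q (aQ _ _ refl) = <-irrefl refl v<Q
    ¬Std-a-B _ _ (XY _ a≡X _) = <-irrefl (sym a≡X) X<a

    ¬Std-B-Q : ∀ {t u} → a < u → u < Y → ¬ Std X Y t u Q
    ¬Std-B-Q a<u _ (QA _ u≤X _) = <⇒≱ (<-trans X<a a<u) u≤X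
    ¬Std-B-Q _ _ (aA _ _ Q≡a) = <-irrefl (sym Q≡a) a<Q
    ¬Std-B-Q a<u _ (aB refl _ _) = <-irrefl refl a<u
    ¬Std-B-Q _ u<Y (QB Y≤u _ _) = <⇒≱ u<Y Y≤u
    ¬Std-B-Q a<u _ (aQ _ refl _) = <-irrefl refl a<u
    ¬Std-B-Q _ _ (XY _ _ Q≡Y) = <-irrefl (sym Q≡Y) Y<Q

    Std-A-B : ∀ {t u v} → u < a → a < v → v < Q → Std X Y t u v → t ≡ true × u ≡ X × v ≡ Y
    Std-A-B _ _ v<Q (QA _ _ refl) = ⊥-elim (<-irrefl refl v<Q)
    Std-A-B _ a<v _ (aA _ _ refl) = ⊥-elim (<-irrefl refl a<v)
    Std-A-B u<a _ _ (aB refl _ _) = ⊥-elim (<-irrefl refl u<a)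
    Std-A-B _ _ v<Q (QB _ _ refl) = ⊥-elim (<-irrefl refl v<Q)
    Std-A-B u<a _ _ (aQ _ refl _) = ⊥-elim (<-irrefl refl u<a)
    Std-A-B _ _ _ (XY t u≡X v≡Y) = t , u≡X , v≡Y

    Std-a-Q : ∀ {t} → Std X Y t a Q → t ≡ false
    Std-a-Q (QA _ a≤X _) = ⊥-elim (<⇒≱ X<a a≤X)
    Std-a-Q (aA _ _ Q≡a) = ⊥-elim (<-irrefl (sym Q≡a) a<Q)
    Std-a-Q (aB _ _ Q≤Y) = ⊥-elim (<⇒≱ Y<Q Q≤Y)
    Std-a-Q (QB Y≤a _ _) = ⊥-elim (<⇒≱ a<Y Y≤a)
    Std-a-Q (aQ t _ _) = t
    Std-a-Q (XY _ a≡X _) = ⊥-elim (<-irrefl (sym a≡X) X<a)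

    edge-X-a : ∀ {t} → Edge (Std X Y t) X a
    edge-X-a with suc X ≟ a
    ... | yes 1+X≡a = inj₁ (inj₁ 1+X≡a)
    ... | no 1+X≢a = inj₂ (aA ≤-refl (≤∧≢⇒< X<a 1+X≢a) refl)

    X-minimal : ∀ {t u} → u < X → ¬ Edge (Std X Y t) u a
    X-minimal u<X (inj₁ (inj₁ refl)) = <⇒≱ X<a u<X
    X-minimal _ (inj₁ (inj₂ (_ , 1+a≡n))) = <-irrefl (suc-injective (trans 1+a≡n (sym 1+Q≡n))) a<Q
    X-minimal u<X (inj₂ s) = ¬Std-A-a u<X s

    edge-a-Y : ∀ {t} → Edge (Std X Y t) a Y
    edge-a-Y with suc a ≟ Y
    ... | yes 1+a≡Y = inj₁ (inj₁ 1+a≡Y)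
    ... | no 1+a≢Y = inj₂ (aB refl (≤∧≢⇒< a<Y 1+a≢Y) ≤-refl)

    Y-maximal : ∀ {t v} → Y < v → v < Q → ¬ Edge (Std X Y t) a v
    Y-maximal Y<v _ (inj₁ (inj₁ refl)) = <⇒≱ a<Y (s≤s⁻¹ Y<v)
    Y-maximal _ v<Q (inj₁ (inj₂ (_ , 1+v≡n))) = <-irrefl (suc-injective (trans 1+v≡n (sym 1+Q≡n))) v<Q
    Y-maximal Y<v v<Q (inj₂ s) = ¬Std-a-B Y<v v<Q s

    flip-a-Q : Flip (Std X Y false) (Std X Y true)
    flip-a-Q = record
      { I = a ; J = Q ; K = X ; L = Y
      ; removed = aQ refl refl refl ; added = XY refl refl refl ; crossing = inj₂ (X<a , a<Y , Y<Q)
      ; kept = λ { (QA p q r) → inj₁ (QA p q r) ; (aA p q r) → inj₁ (aA p q r) ; (aB p q r) → inj₁ (aB p q r)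
                 ; (QB p q r) → inj₁ (QB p q r) ; (aQ _ q r) → inj₂ (q , r) ; (XY () _ _) }
      ; kept′ = λ { (QA p q r) → inj₁ (QA p q r) ; (aA p q r) → inj₁ (aA p q r) ; (aB p q r) → inj₁ (aB p q r)
                  ; (QB p q r) → inj₁ (QB p q r) ; (aQ () _ _) ; (XY _ q r) → inj₂ (q , r) }
      }

    flip-Y : ∀ {Y′} → suc Y ≡ Y′ → Y′ < Q → Flip (Std X Y false) (Std X Y′ false)
    flip-Y {Y′} refl Y′<Q = record
      { I = Y ; J = Q ; K = a ; L = Y′
      ; removed = QB ≤-refl Y′<Q refl ; added = aB refl (s≤s a<Y) ≤-refl
      ; crossing = inj₂ (a<Y , n<1+n Y , Y′<Q)
      ; kept = kept ; kept′ = kept′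
      }
      where
      kept : Std X Y false ⇒ λ u v → Std X Y′ false u v ⊎ (u ≡ Y × v ≡ Q)
      kept (QA p q r) = inj₁ (QA p q r)
      kept (aA p q r) = inj₁ (aA p q r)
      kept (aB p q r) = inj₁ (aB p q (m≤n⇒m≤1+n r))
      kept (QB p q r) with m≤n⇒m<n∨m≡n p
      ... | inj₁ Y<u = inj₁ (QB Y<u q r)
      ... | inj₂ Y≡u = inj₂ (sym Y≡u , r)
      kept (aQ p q r) = inj₁ (aQ p q r)
      kept (XY () _ _)
      kept′ : Std X Y′ false ⇒ λ u v → Std X Y false u v ⊎ (u ≡ a × v ≡ Y′)
      kept′ (QA p q r) = inj₁ (QA p q r)
      kept′ (aA p q r) = inj₁ (aA p q r)
      kept′ (aB p q r) with m≤n⇒m<n∨m≡n r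
      ... | inj₁ v<Y′ = inj₁ (aB p q (s≤s⁻¹ v<Y′))
      ... | inj₂ v≡Y′ = inj₂ (p , v≡Y′)
      kept′ (QB p q r) = inj₁ (QB (<⇒≤ p) q r)
      kept′ (aQ p q r) = inj₁ (aQ p q r)
      kept′ (XY () _ _)

    flip-X : ∀ {X′} → suc X ≡ X′ → X′ < a → Flip (Std X Y false) (Std X′ Y false)
    flip-X {X′} refl X′<a = record
      { I = X ; J = a ; K = X′ ; L = Q
      ; removed = aA ≤-refl X′<a refl ; added = QA (s≤s z≤n) ≤-refl refl
      ; crossing = inj₁ (n<1+n X , X′<a , a<Q)
      ; kept = kept ; kept′ = kept′
      }
      where
      kept : Std X Y false ⇒ λ u v → Std X′ Y false u v ⊎ (u ≡ X × v ≡ a)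
      kept (QA p q r) = inj₁ (QA p (m≤n⇒m≤1+n q) r)
      kept (aA p q r) with m≤n⇒m<n∨m≡n p
      ... | inj₁ X<u = inj₁ (aA X<u q r)
      ... | inj₂ X≡u = inj₂ (sym X≡u , r)
      kept (aB p q r) = inj₁ (aB p q r)
      kept (QB p q r) = inj₁ (QB p q r)
      kept (aQ p q r) = inj₁ (aQ p q r)
      kept (XY () _ _)
      kept′ : Std X′ Y false ⇒ λ u v → Std X Y false u v ⊎ (u ≡ X′ × v ≡ Q)
      kept′ (QA p q r) with m≤n⇒m<n∨m≡n q
      ... | inj₁ u<X′ = inj₁ (QA p (s≤s⁻¹ u<X′) r)
      ... | inj₂ u≡X′ = inj₂ (u≡X′ , r)
      kept′ (aA p q r) = inj₁ (aA (<⇒≤ p) q r)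
      kept′ (aB p q r) = inj₁ (aB p q r)
      kept′ (QB p q r) = inj₁ (QB p q r)
      kept′ (aQ p q r) = inj₁ (aQ p q r)
      kept′ (XY () _ _)

  module Pair {X Y X′ Y′ : ℕ} (X<a : X < a) (a<Y : a < Y) (Y<Q : Y < Q)
                               (X′<a : X′ < a) (a<Y′ : a < Y′) (Y′<Q : Y′ < Q) where
    private
      module S = Standard X<a a<Y Y<Q
      module S′ = Standard X′<a a<Y′ Y′<Q

      same-flag : ∀ {t t′} → Std X Y t ⇒ Std X′ Y′ t′ → Std X′ Y′ t′ ⇒ Std X Y t → t ≡ t′
      same-flag {false} {false} _ _ = refl
      same-flag {true}  {true}  _ _ = refl
      same-flag {false} {true}  ⊆ _ = sym (S′.Std-a-Q (⊆ (aQ refl refl refl)))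
      same-flag {true}  {false} _ ⊇ = S.Std-a-Q (⊇ (aQ refl refl refl))

    Std-injective : ∀ {t t′} → Std X Y t ⇒ Std X′ Y′ t′ → Std X′ Y′ t′ ⇒ Std X Y t → X ≡ X′ × Y ≡ Y′ × t ≡ t′
    Std-injective {t} {t′} ⊆ ⊇ = X≡X′ , Y≡Y′ , t≡t′
      where
      X≡X′ : X ≡ X′
      X≡X′ with <-cmp X X′
      ... | tri< X<X′ _ _ = ⊥-elim (S′.X-minimal X<X′ (Edge-map {R′ = Std X′ Y′ t′} ⊆ S.edge-X-a))
      ... | tri≈ _ X≡X′ _ = X≡X′
      ... | tri> _ _ X′<X = ⊥-elim (S.X-minimal X′<X (Edge-map {R′ = Std X Y t} ⊇ S′.edge-X-a))
      Y≡Y′ : Y ≡ Y′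
      Y≡Y′ with <-cmp Y Y′
      ... | tri< Y<Y′ _ _ = ⊥-elim (S.Y-maximal Y<Y′ Y′<Q (Edge-map {R′ = Std X Y t} ⊇ S′.edge-a-Y))
      ... | tri≈ _ Y≡Y′ _ = Y≡Y′
      ... | tri> _ _ Y′<Y = ⊥-elim (S′.Y-maximal Y′<Y Y<Q (Edge-map {R′ = Std X′ Y′ t′} ⊆ S.edge-a-Y))
      t≡t′ : t ≡ t′
      t≡t′ = same-flag ⊆ ⊇

    -- In each case below, the flip would have to add, or to remove, two distinct diagonals.
    flip-with-X<X′ : ∀ {t t′} → Flip (Std X Y t) (Std X′ Y′ t′) → X < X′ →
                     t ≡ false × t′ ≡ false × Y ≡ Y′ × suc X ≡ X′
    flip-with-X<X′ {t} {t′} f X<X′ = t≡false , t′≡false , Y≡Y′ , 1+X≡X′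
      where
      open Flip f
      added-is-X′Q : ∀ {u v} → Std X′ Y′ t′ u v → ¬ Std X Y t u v → u ≡ X′ × v ≡ Q
      added-is-X′Q s′ ¬s = added-unique s′ ¬s (QA (≤-<-trans z≤n X<X′) ≤-refl refl) (S.¬Std-A-Q X<X′ X′<a)

      Y≡Y′ : Y ≡ Y′
      Y≡Y′ with <-cmp Y Y′
      ... | tri< Y<Y′ _ _ =
        let a≡X′ , _ = added-is-X′Q (aB refl (≤-<-trans a<Y Y<Y′) ≤-refl) (S.¬Std-a-B Y<Y′ Y′<Q)
        in ⊥-elim (<-irrefl (sym a≡X′) X′<a)
      ... | tri≈ _ Y≡Y′ _ = Y≡Y′
      ... | tri> _ _ Y′<Y =
        let Y′≡X′ , _ = added-is-X′Q (QB ≤-refl (≤-<-trans Y′<Y Y<Q) refl) (S.¬Std-B-Q a<Y′ Y′<Y)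
        in ⊥-elim (<-asym (subst (_< a) (sym Y′≡X′) X′<a) a<Y′)

      t′≡false : t′ ≡ false
      t′≡false = ¬-not λ t′≡true →
        let _ , Y′≡Q = added-is-X′Q (XY t′≡true refl refl)
                                    (λ s → <-irrefl (sym (proj₁ (proj₂ (S.Std-A-B X′<a a<Y′ Y′<Q s)))) X<X′)
        in <-irrefl Y′≡Q Y′<Q

      t≡false : t ≡ false
      t≡false = ¬-not λ t≡true →
        let _ , Y≡a = removed-unique (XY t≡true refl refl)
                                     (λ s′ → <-irrefl (proj₁ (proj₂ (S′.Std-A-B X<a a<Y Y<Q s′))) X<X′)
                                     (aA ≤-refl (≤-<-trans X<X′ X′<a) refl) (S′.¬Std-A-a X<X′)
        in <-irrefl (sym Y≡a) a<Y

      1+X≡X′ : suc X ≡ X′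
      1+X≡X′ with <-cmp (suc X) X′
      ... | tri< 1+X<X′ _ _ =
        let 1+X≡X′ , _ = added-is-X′Q (QA (s≤s z≤n) (<⇒≤ 1+X<X′) refl)
                                      (S.¬Std-A-Q (n<1+n X) (<-trans 1+X<X′ X′<a))
        in ⊥-elim (<-irrefl 1+X≡X′ 1+X<X′)
      ... | tri≈ _ 1+X≡X′ _ = 1+X≡X′
      ... | tri> _ _ X′<1+X = ⊥-elim (<⇒≱ X<X′ (s≤s⁻¹ X′<1+X))

    flip-with-Y<Y′ : ∀ {t t′} → Flip (Std X Y t) (Std X′ Y′ t′) → Y < Y′ →
                     t ≡ false × t′ ≡ false × suc Y ≡ Y′
    flip-with-Y<Y′ {t} {t′} f Y<Y′ = t≡false , t′≡false , 1+Y≡Y′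
      where
      open Flip f
      added-is-aY′ : ∀ {u v} → Std X′ Y′ t′ u v → ¬ Std X Y t u v → u ≡ a × v ≡ Y′
      added-is-aY′ s′ ¬s = added-unique s′ ¬s (aB refl (≤-<-trans a<Y Y<Y′) ≤-refl) (S.¬Std-a-B Y<Y′ Y′<Q)

      t′≡false : t′ ≡ false
      t′≡false = ¬-not λ t′≡true →
        let X′≡a , _ = added-is-aY′ (XY t′≡true refl refl)
                                    (λ s → <-irrefl (sym (proj₂ (proj₂ (S.Std-A-B X′<a a<Y′ Y′<Q s)))) Y<Y′)
        in <-irrefl X′≡a X′<a

      t≡false : t ≡ false
      t≡false = ¬-not λ t≡true →
        let X≡Y , _ = removed-unique (XY t≡true refl refl)
                                     (λ s′ → <-irrefl (proj₂ (proj₂ (S′.Std-A-B X<a a<Y Y<Q s′))) Y<Y′)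
                                     (QB ≤-refl (≤-<-trans Y<Y′ Y′<Q) refl) (S′.¬Std-B-Q a<Y Y<Y′)
        in <-irrefl X≡Y (<-trans X<a a<Y)

      1+Y≡Y′ : suc Y ≡ Y′
      1+Y≡Y′ with <-cmp (suc Y) Y′
      ... | tri< 1+Y<Y′ _ _ =
        let _ , 1+Y≡Y′ = added-is-aY′ (aB refl (s≤s a<Y) (<⇒≤ 1+Y<Y′))
                                      (S.¬Std-a-B (n<1+n Y) (<-trans 1+Y<Y′ Y′<Q))
        in ⊥-elim (<-irrefl 1+Y≡Y′ 1+Y<Y′)
      ... | tri≈ _ 1+Y≡Y′ _ = 1+Y≡Y′
      ... | tri> _ _ Y′<1+Y = ⊥-elim (<⇒≱ Y<Y′ (s≤s⁻¹ Y′<1+Y))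

  red : ∀ {k} → k ≢ a → k ≢ Q → isBlue k ≡ false
  red k≢a k≢Q = ¬-not λ blue → [ k≢a , k≢Q ]′ (to T-isBlue (subst T (sym blue) _))

  module Classification (1≤a : 1 ≤ a) (1≤b : 1 ≤ b) {R : Rel ℕ 0ℓ}
                        (R-tri : IsTriangulation R) (R? : Decidable R) (colorful : Colorful isBlue R) where
    open IsTriangulation R-tri

    private
      least-neighbour : ∃ λ X → X ≤ a ∸ 1 × Edge R X a × (∀ {u} → u < X → ¬ Edge R u a)
      least-neighbour = least-satisfying (λ u → edge? R-tri R? u a) {a ∸ 1} (inj₁ (inj₁ (m+[n∸m]≡n 1≤a)))
      greatest-neighbour : ∃ λ Y → Y < Q × (a < Y × Edge R a Y) ×
                                   (∀ {v} → Y < v → v < Q → ¬ (a < v × Edge R a v))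
      greatest-neighbour = greatest-below (λ v → (a <? v) ×-dec edge? R-tri R? a v)
                                          (s≤s (m<m+n a 1≤b)) (n<1+n a , inj₁ (inj₁ refl))

    X : ℕ
    X = proj₁ least-neighbour

    X<a : X < a
    X<a = subst (suc X ≤_) (m+[n∸m]≡n 1≤a) (s≤s (proj₁ (proj₂ least-neighbour)))

    X-a : Edge R X a
    X-a = proj₁ (proj₂ (proj₂ least-neighbour))

    X-least : ∀ {u} → Edge R u a → X ≤ u
    X-least e = ≮⇒≥ λ u<X → proj₂ (proj₂ (proj₂ least-neighbour)) u<X e

    Y : ℕ
    Y = proj₁ greatest-neighbour

    Y<Q : Y < Q
    Y<Q = proj₁ (proj₂ greatest-neighbour)

    a<Y : a < Y
    a<Y = proj₁ (proj₁ (proj₂ (proj₂ greatest-neighbour)))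

    a-Y : Edge R a Y
    a-Y = proj₂ (proj₁ (proj₂ (proj₂ greatest-neighbour)))

    Y-greatest : ∀ {v} → a < v → v < Q → Edge R a v → v ≤ Y
    Y-greatest a<v v<Q e = ≮⇒≥ λ Y<v → proj₂ (proj₂ (proj₂ greatest-neighbour)) Y<v v<Q (a<v , e)

    t : Bool
    t = not (does (R? a Q))

    private
      ¬diagonal-in-A : ∀ {i j} → R i j → j < a → ⊥
      ¬diagonal-in-A r j<a = ¬monochromatic-span R-tri R? colorful r λ _ k≤j →
        red (<⇒≢ (≤-<-trans k≤j j<a)) (<⇒≢ (≤-<-trans k≤j (<-trans j<a a<Q)))

      ¬diagonal-in-B : ∀ {i j} → R i j → a < i → j < Q → ⊥
      ¬diagonal-in-B r a<i j<Q = ¬monochromatic-span R-tri R? colorful r λ i≤k k≤j →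
        red (≢-sym (<⇒≢ (<-≤-trans a<i i≤k))) (<⇒≢ (≤-<-trans k≤j j<Q))

      apex-is-a : ∀ {i j} → R i j → i < a → a < j → j < Q → Edge R i a × Edge R a j
      apex-is-a {i} {j} r i<a a<j j<Q with apex R-tri R? r
      ... | k , tri@(i<k , k<j , _ , ik , kj , _) with k ≟ a
      ...   | yes refl = ik , kj
      ...   | no k≢a = ⊥-elim (colorful tri (trans red-i (sym red-k)) (trans red-k (sym red-j)))
        where
        red-i : isBlue i ≡ false
        red-i = red (<⇒≢ i<a) (<⇒≢ (<-trans i<a a<Q))
        red-k : isBlue k ≡ false
        red-k = red k≢a (<⇒≢ (<-trans k<j j<Q))
        red-j : isBlue j ≡ false
        red-j = red (≢-sym (<⇒≢ a<j)) (<⇒≢ j<Q)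

    contained : R ⇒ Std X Y t
    contained {i} {j} r with diagonal r | <-cmp j a
    ... | d , _ | tri< j<a _ _ = ⊥-elim (¬diagonal-in-A r j<a)
    ... | d , _ | tri≈ _ refl _ = aA (X-least (inj₂ r)) (Diagonal⇒1+i<j d) refl
    ... | d , j<n | tri> _ _ a<j with <-cmp j Q | <-cmp i a
    ...   | tri< j<Q _ _ | tri< i<a _ _ = XY t≡true i≡X j≡Y
      where
      i≡X : i ≡ X
      i≡X = ≤-antisym (≮⇒≥ λ X<i → Edge-nonCrossing isNonCrossing r X-a (inj₂ (X<i , i<a , a<j)))
                      (X-least (proj₁ (apex-is-a r i<a a<j j<Q)))
      j≡Y : j ≡ Y
      j≡Y = ≤-antisym (Y-greatest a<j j<Q (proj₂ (apex-is-a r i<a a<j j<Q)))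
                      (≮⇒≥ λ j<Y → Edge-nonCrossing isNonCrossing r a-Y (inj₁ (i<a , a<j , j<Y)))
      t≡true : t ≡ true
      t≡true = cong not (dec-false (R? a Q) λ aQ∈R → nonCrossing r aQ∈R (inj₁ (i<a , a<j , j<Q)))
    ...   | tri< j<Q _ _ | tri≈ _ refl _ = aB refl (Diagonal⇒1+i<j d) (Y-greatest a<j j<Q (inj₂ r))
    ...   | tri< j<Q _ _ | tri> _ _ a<i = ⊥-elim (¬diagonal-in-B r a<i j<Q)
    ...   | tri≈ _ refl _ | tri< i<a _ _ =
      QA (Diagonal-to-Q⇒1≤i d) (≮⇒≥ λ X<i → Edge-nonCrossing isNonCrossing r X-a (inj₂ (X<i , i<a , a<Q))) refl
    ...   | tri≈ _ refl _ | tri≈ _ refl _ = aQ (cong not (dec-true (R? a Q) r)) refl refl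
    ...   | tri≈ _ refl _ | tri> _ _ a<i =
      QB (≮⇒≥ λ i<Y → Edge-nonCrossing isNonCrossing r a-Y (inj₂ (a<i , i<Y , Y<Q))) (Diagonal⇒1+i<j d) refl
    ...   | tri> _ _ Q<j | _ = contradiction (<n⇒≤Q j<n) (<⇒≱ Q<j)

    classified : ∀ {i j} → R i j ⇔ Std X Y t i j
    classified = mk⇔ contained (⊆-nonCrossing⇒⊇ R-tri R? (Standard.Std-isNonCrossing X<a a<Y Y<Q) contained)

  B-point : Fin b → ℕ
  B-point y = suc (a + toℕ y)

  a<B-point : ∀ y → a < B-point y
  a<B-point y = s≤s (m≤m+n a (toℕ y))

  B-point<Q : ∀ y → B-point y < Q
  B-point<Q y = s≤s (+-monoʳ-< a (toℕ<n y))

  B-point-injective : ∀ {y y′} → B-point y ≡ B-point y′ → y ≡ y′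
  B-point-injective e = toℕ-injective (+-cancelˡ-≡ a _ _ (suc-injective e))

  B-point-suc : ∀ {y y′} → suc (toℕ y) ≡ toℕ y′ ⇔ suc (B-point y) ≡ B-point y′
  B-point-suc {y} = mk⇔ (λ e → cong suc (trans (sym (+-suc a (toℕ y))) (cong (a +_) e)))
                        (λ e → +-cancelˡ-≡ a _ _ (trans (+-suc a (toℕ y)) (suc-injective e)))

  B-point-view : ∀ {Y} → a < Y → Y < Q → ∃ λ y → B-point y ≡ Y
  B-point-view {Y} a<Y Y<Q = fromℕ< k<b , trans (cong (λ k → suc (a + k)) (toℕ-fromℕ< k<b)) (m+[n∸m]≡n a<Y)
    where
    k<b : Y ∸ suc a < b
    k<b = +-cancelˡ-< a _ _ (s≤s⁻¹ (subst (_< Q) (sym (m+[n∸m]≡n a<Y)) Y<Q))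

  StdAt : Fin a × Fin b × Bool → Rel ℕ 0ℓ
  StdAt (x , y , t) = Std (toℕ x) (B-point y) t

  StdAt? : ∀ g → Decidable (StdAt g)
  StdAt? (x , y , t) = Std? (toℕ x) (B-point y) t

  module StandardAt (x : Fin a) (y : Fin b) = Standard (toℕ<n x) (a<B-point y) (B-point<Q y)
  module PairAt (x : Fin a) (y : Fin b) (x′ : Fin a) (y′ : Fin b) =
    Pair (toℕ<n x) (a<B-point y) (B-point<Q y) (toℕ<n x′) (a<B-point y′) (B-point<Q y′)

  StdAt-isTriangulation : ∀ g → IsTriangulation (StdAt g)
  StdAt-isTriangulation (x , y , _) = StandardAt.Std-isTriangulation x y

  StdAt-colorful : ∀ g → Colorful isBlue (StdAt g)
  StdAt-colorful (x , y , _) = StandardAt.Std-colorful x y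

  StdAt-bounded : ∀ g {i j} → StdAt g i j → i < n × j < n
  StdAt-bounded (x , y , _) = StandardAt.Std-bounded x y

  StdAt-injective : ∀ g h → StdAt g ⇒ StdAt h → StdAt h ⇒ StdAt g → g ≡ h
  StdAt-injective (x , y , t) (x′ , y′ , t′) ⊆ ⊇
    with X≡X′ , Y≡Y′ , refl ← PairAt.Std-injective x y x′ y′ ⊆ ⊇
    with refl ← toℕ-injective X≡X′ | refl ← B-point-injective Y≡Y′ = refl

  Flip⇒GridPendAdj : ∀ g h → Flip (StdAt g) (StdAt h) → GridPendAdj a b g h
  Flip⇒GridPendAdj (x , y , t) (x′ , y′ , t′) f with <-cmp (toℕ x) (toℕ x′)
  ... | tri< X<X′ _ _ with refl , refl , Y≡Y′ , 1+X≡X′ ← PairAt.flip-with-X<X′ x y x′ y′ f X<X′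
                      with refl ← B-point-injective Y≡Y′ = vert x x′ y 1+X≡X′
  ... | tri> _ _ X′<X with refl , refl , Y′≡Y , 1+X′≡X ← PairAt.flip-with-X<X′ x′ y′ x y (Flip-sym f) X′<X
                      with refl ← B-point-injective Y′≡Y = vert' x x′ y 1+X′≡X
  ... | tri≈ _ X≡X′ _ with refl ← toℕ-injective X≡X′ with <-cmp (B-point y) (B-point y′)
  ...   | tri< Y<Y′ _ _ with refl , refl , 1+Y≡Y′ ← PairAt.flip-with-Y<Y′ x y x y′ f Y<Y′ =
    horiz x y y′ (from B-point-suc 1+Y≡Y′)
  ...   | tri> _ _ Y′<Y with refl , refl , 1+Y′≡Y ← PairAt.flip-with-Y<Y′ x y′ x y (Flip-sym f) Y′<Y =
    horiz' x y y′ (from B-point-suc 1+Y′≡Y)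
  ...   | tri≈ _ Y≡Y′ _ with refl ← B-point-injective Y≡Y′ = flag-flip t t′ f
    where
    flag-flip : ∀ t t′ → Flip (StdAt (x , y , t)) (StdAt (x , y , t′)) →
                GridPendAdj a b (x , y , t) (x , y , t′)
    flag-flip false true  _ = pend x y
    flag-flip true  false _ = pend' x y
    flag-flip false false f = ⊥-elim (¬Flip-refl (StandardAt.Std-isNonCrossing x y) f)
    flag-flip true  true  f = ⊥-elim (¬Flip-refl (StandardAt.Std-isNonCrossing x y) f)

  GridPendAdj⇒Flip : ∀ g h → GridPendAdj a b g h → Flip (StdAt g) (StdAt h)
  GridPendAdj⇒Flip _ _ (horiz i j j′ e)  = StandardAt.flip-Y i j (to B-point-suc e) (B-point<Q j′)
  GridPendAdj⇒Flip _ _ (horiz' i j j′ e) = Flip-sym (StandardAt.flip-Y i j′ (to B-point-suc e) (B-point<Q j))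
  GridPendAdj⇒Flip _ _ (vert i i′ j e)   = StandardAt.flip-X i j e (toℕ<n i′)
  GridPendAdj⇒Flip _ _ (vert' i i′ j e)  = Flip-sym (StandardAt.flip-X i′ j e (toℕ<n i))
  GridPendAdj⇒Flip _ _ (pend i j)        = StandardAt.flip-a-Q i j
  GridPendAdj⇒Flip _ _ (pend' i j)       = Flip-sym (StandardAt.flip-a-Q i j)

module Isomorphism (a b : ℕ) (1≤a : 1 ≤ a) (1≤b : 1 ≤ b) where
  open Coloured a b
  open ConvexPolygon n
  open Encoding n

  -- Only the specification of the classification is used below; unfolding it is very costly.
  opaque
    classify : ∀ S → T (P.isTriangulation S ∧ P.colorful (colour a b) S) → ∃ λ g → Represents S (StdAt g)
    classify S h = (fromℕ< X<a , y , t) , Represents-cong (Member-represents S) (λ {i j} → relabel ⇔-∘ classified)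
      where
      tri&col : IsTriangulation (Member S) × Colorful isBlue (Member S)
      tri&col = to (T-vertex (Member-represents S)) h
      open Classification 1≤a 1≤b (proj₁ tri&col) (Member? S) (proj₂ tri&col)
      y : Fin b
      y = proj₁ (B-point-view a<Y Y<Q)
      relabel : ∀ {i j} → Std X Y t i j ⇔ Std (toℕ (fromℕ< X<a)) (B-point y) t i j
      relabel {i} {j} = subst₂ (λ X′ Y′ → Std X Y t i j ⇔ Std X′ Y′ t i j)
                               (sym (toℕ-fromℕ< X<a)) (sym (proj₂ (B-point-view a<Y Y<Q))) (⇔-id _)

  cell : V (F a b) → Fin a × Fin b × Bool
  cell (S , h) = proj₁ (classify S h)

  cell-represents : ∀ u → Represents (proj₁ u) (StdAt (cell u))
  cell-represents (S , h) = proj₂ (classify S h)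

  matrix-represents-StdAt : ∀ g → Represents (matrix (StdAt? g)) (StdAt g)
  matrix-represents-StdAt g = matrix-represents (StdAt? g) (StdAt-bounded g)

  vertex : Fin a × Fin b × Bool → V (F a b)
  vertex g = matrix (StdAt? g) ,
             from (T-vertex (matrix-represents-StdAt g)) (StdAt-isTriangulation g , StdAt-colorful g)

  cell-injective : ∀ {u v} → cell u ≡ cell v → u ≡ v
  cell-injective {S , h} {S′ , h′} cells≡
    with refl ← Represents-unique (cell-represents (S , h))
                                  (subst (Represents S′ ∘ StdAt) (sym cells≡) (cell-represents (S′ , h′)))
    = cong (S ,_) (T-irrelevant h h′)

  cell-vertex : ∀ g → cell (vertex g) ≡ g
  cell-vertex g = StdAt-injective (cell (vertex g)) g
    (Represents-⇒ (cell-represents (vertex g)) (matrix-represents-StdAt g))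
    (Represents-⇒ (matrix-represents-StdAt g) (cell-represents (vertex g)))

  F≅GridWithPendants : F a b ≅ GridWithPendants a b
  F≅GridWithPendants = record
    { bij = mk⤖ {to = cell} (cell-injective , λ g → vertex g , λ { refl → cell-vertex g })
    ; adj = λ u v → mk⇔ (Flip⇒GridPendAdj _ _) (GridPendAdj⇒Flip _ _)
                    ⇔-∘ Flip⇔ (cell-represents u) (cell-represents v) (nonCrossing u) (nonCrossing v)
    }
    where
    nonCrossing : ∀ u → IsNonCrossing (StdAt (cell u))
    nonCrossing u = IsTriangulation.isNonCrossing (StdAt-isTriangulation (cell u))

theorem4 : (a b : ℕ) → 1 ≤ a → 1 ≤ b →
    (F a b ≅ GridWithPendants a b) × (2 < a * b → ¬ HamiltonPath (F a b))
theorem4 a b 1≤a 1≤b = F≅Grid , λ 3≤ab → GridWithPendants-¬HamiltonPath a b 3≤ab ∘ ≅-HamiltonPath F≅Grid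
  where
  F≅Grid : F a b ≅ GridWithPendants a b
  F≅Grid = Isomorphism.F≅GridWithPendants a b 1≤a 1≤b
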